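{- Let $S=(s_1,s_2,\ldots)$ be a packing sequence and let $G$ be a graph. (1) If $s_1=s_2=1$, then $G$ is $3$-$\chi_S$-critical if and only if $G\in\{C_{2k+1}:\ k\ge 1\}$. (2) If $s_1=1$ and $s_2\ge 2$, then $G$ is $3$-$\chi_S$-critical if and only if $G\in\{C_3,C_4,P_4\}$. (3) If $s_1\ge 2$, then $G$ is $3$-$\chi_S$-critical if and only if $G\in\{C_3,P_3\}$.
   Context: A packing sequence is a non-decreasing sequence $S=(s_1,s_2,\ldots)$ of positive integers other than the constant sequence $(1,1,\ldots)$. An $S$-packing $k$-coloring of a graph $G$ is a map $c:V(G)\to\{1,\ldots,k\}$ such that whenever $u\neq v$ and $c(u)=c(v)=i$, the shortest-path distance satisfies $d_G(u,v)>s_i$. The $S$-packing chromatic number $\chi_S(G)$ is the least $k$ such that $G$ admits an $S$-packing $k$-coloring. A graph $G$ is $\chi_S$-critical if $\chi_S(G-u)<\chi_S(G)$ for every $u\in V(G)$, and $k$-$\chi_S$-critical if moreover $\chi_S(G)=k$. $C_n$ and $P_n$ denote the cycle and path on $n$ vertices. -}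

module Defs where

open import Data.Nat using (ℕ; zero; suc; _+_; _*_; _<_; _≤_; _%_; _≡ᵇ_)
open import Data.Fin using (Fin; toℕ; punchIn)
open import Data.Bool using (Bool; true; false; _∨_)
open import Data.Product using (Σ; ∃; _×_)
open import Relation.Binary.PropositionalEquality using (_≡_; _≢_)
open import Relation.Nullary using (¬_)
open import Function.Bundles using (_↔_; Inverse)

Graph : ℕ → Set
Graph n = Fin n → Fin n → Bool

IsSimple : ∀ {n} → Graph n → Set
IsSimple {n} G = (∀ (i j : Fin n) → G i j ≡ G j i) × (∀ (i : Fin n) → G i i ≡ false)

-- Reach G u v d : there is a walk from u to v of length ≤ d, i.e. d_G(u,v) ≤ d
-- (vertices in different components are never within finite distance).
data Reach {n} (G : Graph n) : Fin n → Fin n → ℕ → Set where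
  here : ∀ {u d} → Reach G u u d
  step : ∀ {u w v d} → G u w ≡ true → Reach G w v d → Reach G u v (suc d)

-- Packing sequence, 0-indexed: S 0 = s_1, S 1 = s_2, ...
IsPackingSeq : (ℕ → ℕ) → Set
IsPackingSeq S = (∀ i → 1 ≤ S i) × (∀ i → S i ≤ S (suc i)) × ∃ (λ i → S i ≢ 1)

-- S-packing k-coloring; colour c ∈ Fin k stands for colour (toℕ c + 1),
-- whose distance bound is s_{toℕ c + 1} = S (toℕ c).
HasPackingColoring : (ℕ → ℕ) → ∀ {n} → Graph n → ℕ → Set
HasPackingColoring S {n} G k =
  Σ (Fin n → Fin k) λ c → ∀ (u v : Fin n) → u ≢ v → c u ≡ c v →
    ¬ Reach G u v (S (toℕ (c u)))

IsChiS : (ℕ → ℕ) → ∀ {n} → Graph n → ℕ → Set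
IsChiS S G k = HasPackingColoring S G k × (∀ j → j < k → ¬ HasPackingColoring S G j)

deleteVertex : ∀ {m} → Graph (suc m) → Fin (suc m) → Graph m
deleteVertex G u i j = G (punchIn u i) (punchIn u j)

DeletionDrops : (ℕ → ℕ) → ∀ {n} → Graph n → Fin n → Set
DeletionDrops S {suc m} G u = Σ ℕ λ j → IsChiS S (deleteVertex G u) j × j < 3

Is3ChiSCritical : (ℕ → ℕ) → ∀ {n} → Graph n → Set
Is3ChiSCritical S G = IsChiS S G 3 × (∀ u → DeletionDrops S G u)

Isomorphic : ∀ {n m} → Graph n → Graph m → Set
Isomorphic {n} {m} G H =
  Σ (Fin n ↔ Fin m) λ f → ∀ (i j : Fin n) → G i j ≡ H (Inverse.to f i) (Inverse.to f j)

-- Cycle C_n (used for n ≥ 3): i ~ j iff j ≡ i+1 (mod n) or i ≡ j+1 (mod n)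
cycleG : (n : ℕ) → Graph n
cycleG n i j = ((suc (toℕ i) % suc (n Data.Nat.∸ 1)) ≡ᵇ toℕ j) ∨ ((suc (toℕ j) % suc (n Data.Nat.∸ 1)) ≡ᵇ toℕ i)

pathG : (n : ℕ) → Graph n
pathG n i j = (suc (toℕ i) ≡ᵇ toℕ j) ∨ (suc (toℕ j) ≡ᵇ toℕ i)

module Submission where

-- Criticality is certified by non-2-colorability together with, for every vertex u, a 3-coloring in which
-- u alone has the third color; conversely, in a critical graph every embedded non-2-colorable graph and
-- every odd closed walk passes through all vertices. What is non-2-colorable depends on S.
-- If s₁ ≥ 2, a graph without a path P₃ is a matching, hence 2-colorable; so a critical graph contains a
-- P₃, which must span it, and it is P₃ or C₃.
-- If s₁ = 1 < s₂, a graph without triangles and without P₄ is a star forest, 2-colorable with the centers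
-- in the second color; so a critical graph is a triangle, or a spanning P₄ plus possibly the closing edge.
-- If s₁ = s₂ = 1, packing 2-colorings are proper 2-colorings, so a critical graph has an odd closed walk;
-- a shortest one is an induced odd cycle, and it spans the graph.

open import Defs
open import Data.Nat
  using (ℕ; zero; suc; _+_; _*_; _∸_; _≤_; _<_; z≤n; s≤s; _%_; _≡ᵇ_; _≟_; _<?_; _≤?_; anyUpTo?)
open import Data.Nat.Properties
open import Data.Nat.DivMod using (m<n⇒m%n≡m; n%n≡0; m%n<n)
open import Data.Nat.Tactic.RingSolver using (solve-∀)
open import Data.Fin as F using (Fin; toℕ; punchIn; punchOut; inject≤; #_)
import Data.Fin.Properties as FP
import Data.Fin.Permutation.Components as PC
open import Data.Vec using (Vec; []; _∷_; lookup; tabulate)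
open import Data.Vec.Properties using (lookup∘tabulate)
import Data.Vec.Functional as VF
open import Data.Vec.Relation.Unary.All using ([]; _∷_)
open import Data.Vec.Relation.Unary.AllPairs using ([]; _∷_)
open import Data.Vec.Relation.Unary.Unique.Propositional using (Unique)
open import Data.Vec.Relation.Unary.Unique.Propositional.Properties using (lookup-injective)
open import Data.Bool as B using (Bool; true; false; _∨_; _∧_; not; _xor_; T)
open import Data.Bool.Properties
  using (⇔→≡; not-¬; ¬-not; not-involutive; xor-assoc; xor-comm; xor-same; xor-identityʳ;
         not-distribˡ-xor; not-distribʳ-xor; T-∨; T-∧; T-≡)
open import Data.Product using (Σ; _×_; _,_; proj₁; proj₂)
open import Data.Sum using (_⊎_; inj₁; inj₂; [_,_]′; swap)
open import Data.Empty using (⊥; ⊥-elim)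
open import Relation.Binary.PropositionalEquality
open import Relation.Binary.Definitions using (tri<; tri≈; tri>)
open import Relation.Nullary using (¬_; Dec; yes; no; does; map′)
open import Relation.Nullary.Decidable
  using (_×-dec_; _⊎-dec_; _→-dec_; ¬?; toWitness; T?; dec-true; dec-false)
open import Function.Base using (_∘_)
open import Function.Definitions using (Injective)
open import Function.Bundles using (_⇔_; Inverse; Equivalence; mk↔ₛ′; mk⇔)

Symmetric : ∀ {n} → Graph n → Set
Symmetric {n} G = ∀ (i j : Fin n) → G i j ≡ G j i

Loopless : ∀ {n} → Graph n → Set
Loopless {n} G = ∀ (i : Fin n) → G i i ≡ false

IsHom : ∀ {k n} → Graph k → Graph n → (Fin k → Fin n) → Set
IsHom H G h = ∀ i j → H i j ≡ true → G (h i) (h j) ≡ true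

IsEmbedding : ∀ {k n} → Graph k → Graph n → (Fin k → Fin n) → Set
IsEmbedding H G h = Injective _≡_ _≡_ h × IsHom H G h

IsPackingColoring : (ℕ → ℕ) → ∀ {k n} → Graph n → (Fin n → Fin k) → Set
IsPackingColoring S G c = ∀ u v → u ≢ v → c u ≡ c v → ¬ Reach G u v (S (toℕ (c u)))

false≢true : false ≢ true
false≢true ()

edge⇒≢ : ∀ {n} {G : Graph n} → Loopless G → ∀ {a b} → G a b ≡ true → a ≢ b
edge⇒≢ loopless {a} e refl = false≢true (trans (sym (loopless a)) e)

reach-mono : ∀ {n} {G : Graph n} {u v d e} → d ≤ e → Reach G u v d → Reach G u v e
reach-mono _ here = here
reach-mono (s≤s d≤e) (step x r) = step x (reach-mono d≤e r)

reach-edge : ∀ {n} {G : Graph n} {u v d} → 1 ≤ d → G u v ≡ true → Reach G u v d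
reach-edge 1≤d e = reach-mono 1≤d (step e here)

reach-path₂ : ∀ {n} {G : Graph n} {u w v d} → 2 ≤ d → G u w ≡ true → G w v ≡ true → Reach G u v d
reach-path₂ 2≤d e₁ e₂ = reach-mono 2≤d (step e₁ (step e₂ here))

reach₁-inv : ∀ {n} {G : Graph n} {u v} → Reach G u v 1 → u ≡ v ⊎ G u v ≡ true
reach₁-inv here = inj₁ refl
reach₁-inv (step e here) = inj₂ e

reach-unit : (S : ℕ → ℕ) → ∀ {n k} {G : Graph n} {u v} {x y : Fin k} → x ≡ y → S (toℕ y) ≡ 1 →
  Reach G u v (S (toℕ x)) → u ≡ v ⊎ G u v ≡ true
reach-unit S refl S≡1 r = reach₁-inv (subst (Reach _ _ _) S≡1 r)

reach-hom : ∀ {k n} {H : Graph k} {G : Graph n} {h : Fin k → Fin n} → IsHom H G h →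
  ∀ {u v d} → Reach H u v d → Reach G (h u) (h v) d
reach-hom hom here = here
reach-hom hom (step e r) = step (hom _ _ e) (reach-hom hom r)

edgeless-reach : ∀ {n} {G : Graph n} → (∀ a b → G a b ≢ true) → ∀ {u v d} → Reach G u v d → u ≡ v
edgeless-reach _ here = refl
edgeless-reach edgeless (step e _) = ⊥-elim (edgeless _ _ e)

S-positive : ∀ {S} → IsPackingSeq S → ∀ i → 1 ≤ S i
S-positive = proj₁

S-least : ∀ {S} → IsPackingSeq S → ∀ i → S 0 ≤ S i
S-least ps zero = ≤-refl
S-least ps (suc i) = ≤-trans (S-least ps i) (proj₁ (proj₂ ps) i)

packingColoring-proper : ∀ {S} → IsPackingSeq S → ∀ {k n} {G : Graph n} {c : Fin n → Fin k} →
  Loopless G → IsPackingColoring S G c → ∀ a b → G a b ≡ true → c a ≢ c b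
packingColoring-proper ps loopless ok a b e eq =
  ok a b (edge⇒≢ loopless e) eq (reach-edge (S-positive ps _) e)

coloring-pullback : ∀ S {k n} {H : Graph k} {G : Graph n} {h : Fin k → Fin n} → IsEmbedding H G h →
  ∀ {c} → HasPackingColoring S G c → HasPackingColoring S H c
coloring-pullback S {h = h} (inj , hom) (c , ok) =
  (λ i → c (h i)) , λ u v u≢v eq r → ok (h u) (h v) (λ e → u≢v (inj e)) eq (reach-hom hom r)

coloring-weaken : ∀ S {n} {G : Graph n} {j k} → j ≤ k →
  HasPackingColoring S G j → HasPackingColoring S G k
coloring-weaken S {G = G} j≤k (c , ok) =
  (λ v → inject≤ (c v) j≤k) ,
  λ u v u≢v eq r → ok u v u≢v (FP.inject≤-injective j≤k j≤k (c u) (c v) eq)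
    (subst (λ t → Reach G u v (S t)) (FP.toℕ-inject≤ (c u) j≤k) r)

-- χ_S-critical graphs

chiS≡3⇒¬2-colorable : ∀ {S n} {G : Graph n} → IsChiS S G 3 → ¬ HasPackingColoring S G 2
chiS≡3⇒¬2-colorable χ≡3 = proj₂ χ≡3 2 (s≤s (s≤s (s≤s z≤n)))

deletionDrops⇒2-colorable : ∀ {S m} {G : Graph (suc m)} u → DeletionDrops S G u →
  HasPackingColoring S (deleteVertex G u) 2
deletionDrops⇒2-colorable {S} u (j , χ≡j , j<3) = coloring-weaken S (≤-pred j<3) (proj₁ χ≡j)

2-colorable⇒chiS<3 : ∀ {S} → IsPackingSeq S → ∀ {m} (H : Graph m) → Loopless H →
  HasPackingColoring S H 2 → Σ ℕ λ j → IsChiS S H j × j < 3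
2-colorable⇒chiS<3 {S} ps {m} H loopless col₂
  with FP.any? (λ a → FP.any? (λ b → H a b B.≟ true))
... | yes (a , b , e) = 2 , (col₂ , fewer) , s≤s (s≤s (s≤s z≤n))
  where
  fewer : ∀ j → j < 2 → ¬ HasPackingColoring S H j
  fewer zero _ (c , _) = FP.¬Fin0 (c a)
  fewer (suc zero) _ (c , ok) =
    ok a b (edge⇒≢ loopless e) (fin1 (c a) (c b)) (reach-edge (S-positive ps _) e)
    where
    fin1 : (x y : Fin 1) → x ≡ y
    fin1 F.zero F.zero = refl
  fewer (suc (suc j)) (s≤s (s≤s ()))
... | no noEdge with m
...   | zero = 0 , (((λ ()) , (λ ())) , λ _ ()) , s≤s z≤n
...   | suc _ = 1 , ((monochrome , fewer) , s≤s (s≤s z≤n))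
  where
  monochrome : HasPackingColoring S H 1
  monochrome =
    (λ _ → F.zero) , λ u v u≢v _ r → u≢v (edgeless-reach (λ a b e → noEdge (a , b , e)) r)
  fewer : ∀ j → j < 1 → ¬ HasPackingColoring S H j
  fewer zero _ (c , _) = FP.¬Fin0 (c F.zero)
  fewer (suc j) (s≤s ())

third : Fin 3
third = # 2

IsolatingColoring : (ℕ → ℕ) → ∀ {n} → Graph n → Fin n → Set
IsolatingColoring S {n} G u =
  Σ (Fin n → Fin 3) λ c → IsPackingColoring S G c × c u ≡ third × (∀ v → c v ≡ third → v ≡ u)

dropThird : Fin 3 → Fin 2
dropThird F.zero = F.zero
dropThird (F.suc F.zero) = F.suc F.zero
dropThird (F.suc (F.suc F.zero)) = F.zero

toℕ-dropThird : ∀ x → x ≢ third → toℕ (dropThird x) ≡ toℕ x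
toℕ-dropThird F.zero _ = refl
toℕ-dropThird (F.suc F.zero) _ = refl
toℕ-dropThird (F.suc (F.suc F.zero)) x≢third = ⊥-elim (x≢third refl)

dropThird-injective : ∀ x y → x ≢ third → y ≢ third → dropThird x ≡ dropThird y → x ≡ y
dropThird-injective F.zero F.zero _ _ _ = refl
dropThird-injective (F.suc F.zero) (F.suc F.zero) _ _ _ = refl
dropThird-injective (F.suc (F.suc F.zero)) _ x≢third _ _ = ⊥-elim (x≢third refl)
dropThird-injective _ (F.suc (F.suc F.zero)) _ y≢third _ = ⊥-elim (y≢third refl)

isolating⇒deleted-2-colorable : ∀ S {m} (G : Graph (suc m)) u → IsolatingColoring S G u →
  HasPackingColoring S (deleteVertex G u) 2
isolating⇒deleted-2-colorable S G u (c , ok , _ , only-u) = c′ , ok′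
  where
  c′ : Fin _ → Fin 2
  c′ i = dropThird (c (punchIn u i))
  ≢third : ∀ i → c (punchIn u i) ≢ third
  ≢third i e = FP.punchInᵢ≢i u i (only-u _ e)
  ok′ : IsPackingColoring S (deleteVertex G u) c′
  ok′ a b a≢b eq r = ok (punchIn u a) (punchIn u b) (λ e → a≢b (FP.punchIn-injective u a b e))
     (dropThird-injective _ _ (≢third a) (≢third b) eq)
     (subst (λ t → Reach G (punchIn u a) (punchIn u b) (S t)) (toℕ-dropThird _ (≢third a))
        (reach-hom (λ _ _ e → e) r))

isolating⇒deletionDrops : ∀ S → IsPackingSeq S → ∀ {n} (G : Graph n) → Loopless G →
  ∀ u → IsolatingColoring S G u → DeletionDrops S G u
isolating⇒deletionDrops S ps {suc _} G loopless u isolating =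
  2-colorable⇒chiS<3 ps (deleteVertex G u) (λ _ → loopless _)
    (isolating⇒deleted-2-colorable S G u isolating)

critical-if-isolating : ∀ S → IsPackingSeq S → ∀ {n} (G : Graph n) → Loopless G →
  (∀ u → IsolatingColoring S G u) → Fin n → ¬ HasPackingColoring S G 2 → Is3ChiSCritical S G
critical-if-isolating S ps {n} G loopless isolating x ¬2col =
  (coloring x , fewer) , λ u → isolating⇒deletionDrops S ps G loopless u (isolating u)
  where
  coloring : Fin n → HasPackingColoring S G 3
  coloring x = proj₁ (isolating x) , proj₁ (proj₂ (isolating x))
  fewer : ∀ j → j < 3 → ¬ HasPackingColoring S G j
  fewer j j<3 col = ¬2col (coloring-weaken S (≤-pred j<3) col)

module _ {n m} {G : Graph n} {H : Graph m} (iso : Isomorphic G H) where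
  open Inverse (proj₁ iso)

  iso-embedding : IsEmbedding G H to
  iso-embedding =
      (λ {i} {j} e → trans (sym (strictlyInverseʳ i)) (trans (cong from e) (strictlyInverseʳ j)))
    , λ i j e → trans (sym (proj₂ iso i j)) e

  iso⁻¹-embedding : IsEmbedding H G from
  iso⁻¹-embedding =
      (λ {i} {j} e → trans (sym (strictlyInverseˡ i)) (trans (cong to e) (strictlyInverseˡ j)))
    , λ i j e → trans (proj₂ iso (from i) (from j))
                      (trans (cong₂ H (strictlyInverseˡ i) (strictlyInverseˡ j)) e)

  isolating-transport : ∀ S → (∀ u → IsolatingColoring S H u) → ∀ u → IsolatingColoring S G u
  isolating-transport S isolating u with isolating (to u)
  ... | c , ok , cu , only-u =
    (λ v → c (to v)) , proj₂ (coloring-pullback S iso-embedding (c , ok)) , cu ,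
    λ v e → proj₁ iso-embedding (only-u (to v) e)

critical-if-isomorphic : ∀ S → IsPackingSeq S → ∀ {n m} (G : Graph n) (H : Graph m) → Loopless G →
  Isomorphic G H → (∀ u → IsolatingColoring S H u) → Fin m → ¬ HasPackingColoring S H 2 →
  Is3ChiSCritical S G
critical-if-isomorphic S ps G H loopless iso isolating x ¬2col =
  critical-if-isolating S ps G loopless (isolating-transport iso S isolating)
    (Inverse.from (proj₁ iso) x) (λ col → ¬2col (coloring-pullback S (iso⁻¹-embedding iso) col))

isomorphic-from-enumeration : ∀ {n k} (G : Graph n) (H : Graph k) (h : Fin k → Fin n) →
  Injective _≡_ _≡_ h → (∀ v → Σ (Fin k) λ i → h i ≡ v) → (∀ i j → G (h i) (h j) ≡ H i j) →
  Isomorphic G H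
isomorphic-from-enumeration {n} {k} G H h inj onto edges =
  mk↔ₛ′ index h (λ i → inj (proj₂ (onto (h i)))) (λ v → proj₂ (onto v)) ,
  λ i j → trans (sym (cong₂ G (proj₂ (onto i)) (proj₂ (onto j)))) (edges (index i) (index j))
  where
  index : Fin n → Fin k
  index v = proj₁ (onto v)

embedding-into-deletion : ∀ {k m} {H : Graph k} {G : Graph (suc m)} {h : Fin k → Fin (suc m)} w →
  (∀ i → h i ≢ w) → IsEmbedding H G h → Σ (Fin k → Fin m) (IsEmbedding H (deleteVertex G w))
embedding-into-deletion {k} {m} {G = G} {h} w avoids (inj , hom) = h′ , inj′ , hom′
  where
  w≢h : ∀ i → w ≢ h i
  w≢h i e = avoids i (sym e)
  h′ : Fin k → Fin m
  h′ i = punchOut (w≢h i)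
  punchIn-h′ : ∀ i → punchIn w (h′ i) ≡ h i
  punchIn-h′ i = FP.punchIn-punchOut (w≢h i)
  inj′ : Injective _≡_ _≡_ h′
  inj′ {i} {j} e = inj (FP.punchOut-injective (w≢h i) (w≢h j) e)
  hom′ : IsHom _ (deleteVertex G w) h′
  hom′ i j e = trans (cong₂ G (punchIn-h′ i) (punchIn-h′ j)) (hom i j e)

critical⇒embedding-surjective : ∀ S {k n} (G : Graph n) (H : Graph k) → Is3ChiSCritical S G →
  (h : Fin k → Fin n) → IsEmbedding H G h → ¬ HasPackingColoring S H 2 →
  ∀ w → Σ (Fin k) λ i → h i ≡ w
critical⇒embedding-surjective S {n = suc m} G H critical h emb ¬2col w
  with FP.any? (λ i → h i F.≟ w)
... | yes hit = hit
... | no miss with embedding-into-deletion {G = G} w (λ i e → miss (i , e)) emb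
...   | h′ , emb′ = ⊥-elim (¬2col (coloring-pullback S emb′
                      (deletionDrops⇒2-colorable {S} {G = G} w (proj₂ critical w))))

-- far i records that color i may not repeat at distance 2, i.e. that 2 ≤ S i.
ColoringConflict : ∀ {k} → Graph k → (Fin 2 → Bool) → (Fin k → Fin 2) → Set
ColoringConflict H far c =
    (Σ _ λ u → Σ _ λ v → u ≢ v × c u ≡ c v × H u v ≡ true)
  ⊎ (Σ _ λ u → Σ _ λ w → Σ _ λ v →
       u ≢ v × c u ≡ c v × far (c u) ≡ true × H u w ≡ true × H w v ≡ true)

coloringConflict? : ∀ {k} (H : Graph k) far c → Dec (ColoringConflict H far c)
coloringConflict? H far c =
  FP.any? (λ u → FP.any? λ v → ¬? (u F.≟ v) ×-dec (c u F.≟ c v) ×-dec (H u v B.≟ true)) ⊎-dec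
  FP.any? (λ u → FP.any? λ w → FP.any? λ v →
    ¬? (u F.≟ v) ×-dec (c u F.≟ c v) ×-dec (far (c u) B.≟ true) ×-dec (H u w B.≟ true) ×-dec (H w v B.≟ true))

conflict⇒¬packing : ∀ {S} → IsPackingSeq S → ∀ {k} {H : Graph k} {far} →
  (∀ i → far i ≡ true → 2 ≤ S (toℕ i)) → ∀ {c} → ColoringConflict H far c → ¬ IsPackingColoring S H c
conflict⇒¬packing ps far-ok (inj₁ (u , v , u≢v , eq , e)) ok =
  ok u v u≢v eq (reach-edge (S-positive ps _) e)
conflict⇒¬packing ps far-ok (inj₂ (u , w , v , u≢v , eq , far-cu , e₁ , e₂)) ok =
  ok u v u≢v eq (reach-path₂ (far-ok _ far-cu) e₁ e₂)

isPackingColoring-resp : ∀ S {k n} {H : Graph n} {c c′ : Fin n → Fin k} → (∀ v → c v ≡ c′ v) →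
  IsPackingColoring S H c → IsPackingColoring S H c′
isPackingColoring-resp S {H = H} c≗c′ ok u v u≢v eq r =
  ok u v u≢v (trans (c≗c′ u) (trans eq (sym (c≗c′ v))))
    (subst (λ t → Reach H u v (S (toℕ t))) (sym (c≗c′ u)) r)

all-vectors? : ∀ {m} k {P : Vec (Fin m) k → Set} → (∀ xs → Dec (P xs)) → Dec (∀ xs → P xs)
all-vectors? zero P? = map′ (λ p → λ { [] → p }) (λ p → p []) (P? [])
all-vectors? (suc k) P? =
  map′ (λ p → λ { (x ∷ xs) → p x xs }) (λ p x xs → p (x ∷ xs))
    (FP.all? λ x → all-vectors? k λ xs → P? (x ∷ xs))

¬2-colorable-if-conflicts : ∀ {S} → IsPackingSeq S → ∀ {k} (H : Graph k) far →
  (∀ i → far i ≡ true → 2 ≤ S (toℕ i)) → (∀ (xs : Vec (Fin 2) k) → ColoringConflict H far (lookup xs)) →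
  ¬ HasPackingColoring S H 2
¬2-colorable-if-conflicts {S} ps H far far-ok conflicts (c , ok) =
  conflict⇒¬packing ps far-ok (conflicts (tabulate c))
    (isPackingColoring-resp S (λ v → sym (lookup∘tabulate c v)) ok)

C₃-¬2-colorable : ∀ {S} → IsPackingSeq S → ¬ HasPackingColoring S (cycleG 3) 2
C₃-¬2-colorable ps = ¬2-colorable-if-conflicts ps (cycleG 3) (λ _ → false) (λ _ ())
  (toWitness {a? = all-vectors? 3 λ xs → coloringConflict? (cycleG 3) (λ _ → false) (lookup xs)} _)

P₃-¬2-colorable : ∀ {S} → IsPackingSeq S → 2 ≤ S 0 → ¬ HasPackingColoring S (pathG 3) 2
P₃-¬2-colorable ps 2≤S₀ =
  ¬2-colorable-if-conflicts ps (pathG 3) (λ _ → true) (λ i _ → ≤-trans 2≤S₀ (S-least ps _))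
  (toWitness {a? = all-vectors? 3 λ xs → coloringConflict? (pathG 3) (λ _ → true) (lookup xs)} _)

P₄-¬2-colorable : ∀ {S} → IsPackingSeq S → 2 ≤ S 1 → ¬ HasPackingColoring S (pathG 4) 2
P₄-¬2-colorable {S} ps 2≤S₁ = ¬2-colorable-if-conflicts ps (pathG 4) secondFar secondFar-ok
  (toWitness {a? = all-vectors? 4 λ xs → coloringConflict? (pathG 4) secondFar (lookup xs)} _)
  where
  secondFar : Fin 2 → Bool
  secondFar i = toℕ i ≡ᵇ 1
  secondFar-ok : ∀ i → secondFar i ≡ true → 2 ≤ S (toℕ i)
  secondFar-ok (F.suc F.zero) _ = 2≤S₁

P₄⊆C₄ : IsHom (pathG 4) (cycleG 4) (λ x → x)
P₄⊆C₄ =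
  toWitness {a? = FP.all? λ i → FP.all? λ j → (pathG 4 i j B.≟ true) →-dec (cycleG 4 i j B.≟ true)} _

C₄-¬2-colorable : ∀ {S} → IsPackingSeq S → 2 ≤ S 1 → ¬ HasPackingColoring S (cycleG 4) 2
C₄-¬2-colorable {S} ps 2≤S₁ col =
  P₄-¬2-colorable ps 2≤S₁ (coloring-pullback S ((λ e → e) , P₄⊆C₄) col)

rainbow-isolating : ∀ S (H : Graph 3) x → IsolatingColoring S H x
rainbow-isolating S H x = c , (λ u v u≢v eq _ → u≢v (c-injective eq)) , PC.transpose-inverse x third ,
  λ v cv≡third → trans (sym (PC.transpose-inverse third x)) (cong (PC.transpose third x) cv≡third)
  where
  c : Fin 3 → Fin 3
  c = PC.transpose x third
  c-injective : ∀ {u v} → c u ≡ c v → u ≡ v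
  c-injective {u} {v} eq = trans (sym (PC.transpose-inverse third x))
    (trans (cong (PC.transpose third x) eq) (PC.transpose-inverse third x))

FirstClassIsolating : ∀ {k} → Graph k → (Fin k → Fin 3) → Fin k → Set
FirstClassIsolating H c x =
  c x ≡ third × (∀ v → c v ≡ third → v ≡ x) ×
  (∀ u v → u ≢ v → c u ≡ c v → c u ≡ F.zero × H u v ≡ false)

firstClassIsolating? : ∀ {k} (H : Graph k) c x → Dec (FirstClassIsolating H c x)
firstClassIsolating? H c x =
  (c x F.≟ third) ×-dec FP.all? (λ v → (c v F.≟ third) →-dec (v F.≟ x)) ×-dec
  FP.all? (λ u → FP.all? λ v →
    ¬? (u F.≟ v) →-dec (c u F.≟ c v) →-dec ((c u F.≟ F.zero) ×-dec (H u v B.≟ false)))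

firstClassIsolating⇒isolating : ∀ S → S 0 ≡ 1 → ∀ {k} (H : Graph k) c x → FirstClassIsolating H c x →
  IsolatingColoring S H x
firstClassIsolating⇒isolating S S₀≡1 H c x (cx , only-x , classes) = c , ok , cx , only-x
  where
  ok : IsPackingColoring S H c
  ok u v u≢v eq r with classes u v u≢v eq
  ... | cu≡0 , non-adjacent
      with reach-unit S cu≡0 S₀≡1 r
  ...   | inj₁ u≡v = u≢v u≡v
  ...   | inj₂ e = false≢true (trans (sym non-adjacent) e)

C₄-isolating P₄-isolating : Fin 4 → Vec (Fin 3) 4
C₄-isolating F.zero = third ∷ # 0 ∷ # 1 ∷ # 0 ∷ []
C₄-isolating (F.suc F.zero) = # 0 ∷ third ∷ # 0 ∷ # 1 ∷ []
C₄-isolating (F.suc (F.suc F.zero)) = # 1 ∷ # 0 ∷ third ∷ # 0 ∷ []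
C₄-isolating (F.suc (F.suc (F.suc F.zero))) = # 0 ∷ # 1 ∷ # 0 ∷ third ∷ []
P₄-isolating F.zero = third ∷ # 0 ∷ # 1 ∷ # 0 ∷ []
P₄-isolating (F.suc F.zero) = # 0 ∷ third ∷ # 0 ∷ # 1 ∷ []
P₄-isolating (F.suc (F.suc F.zero)) = # 0 ∷ # 1 ∷ third ∷ # 0 ∷ []
P₄-isolating (F.suc (F.suc (F.suc F.zero))) = # 0 ∷ # 1 ∷ # 0 ∷ third ∷ []

C₄-has-isolating : ∀ S → S 0 ≡ 1 → ∀ x → IsolatingColoring S (cycleG 4) x
C₄-has-isolating S S₀≡1 x =
  firstClassIsolating⇒isolating S S₀≡1 (cycleG 4) (lookup (C₄-isolating x)) x
  (toWitness {a? = FP.all? λ y → firstClassIsolating? (cycleG 4) (lookup (C₄-isolating y)) y} _ x)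

P₄-has-isolating : ∀ S → S 0 ≡ 1 → ∀ x → IsolatingColoring S (pathG 4) x
P₄-has-isolating S S₀≡1 x =
  firstClassIsolating⇒isolating S S₀≡1 (pathG 4) (lookup (P₄-isolating x)) x
  (toWitness {a? = FP.all? λ y → firstClassIsolating? (pathG 4) (lookup (P₄-isolating y)) y} _ x)

critical-if-C₃-or-P₃ : ∀ S → IsPackingSeq S → 2 ≤ S 0 → ∀ {n} (G : Graph n) → Loopless G →
  Isomorphic G (cycleG 3) ⊎ Isomorphic G (pathG 3) → Is3ChiSCritical S G
critical-if-C₃-or-P₃ S ps _ G loopless (inj₁ iso) =
  critical-if-isomorphic S ps G _ loopless iso (rainbow-isolating S _) F.zero (C₃-¬2-colorable ps)
critical-if-C₃-or-P₃ S ps 2≤S₀ G loopless (inj₂ iso) =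
  critical-if-isomorphic S ps G _ loopless iso (rainbow-isolating S _) F.zero (P₃-¬2-colorable ps 2≤S₀)

critical-if-C₃-C₄-or-P₄ : ∀ S → IsPackingSeq S → S 0 ≡ 1 → 2 ≤ S 1 →
  ∀ {n} (G : Graph n) → Loopless G →
  Isomorphic G (cycleG 3) ⊎ Isomorphic G (cycleG 4) ⊎ Isomorphic G (pathG 4) → Is3ChiSCritical S G
critical-if-C₃-C₄-or-P₄ S ps _ _ G loopless (inj₁ iso) =
  critical-if-isomorphic S ps G _ loopless iso (rainbow-isolating S _) F.zero (C₃-¬2-colorable ps)
critical-if-C₃-C₄-or-P₄ S ps S₀≡1 2≤S₁ G loopless (inj₂ (inj₁ iso)) =
  critical-if-isomorphic S ps G _ loopless iso (C₄-has-isolating S S₀≡1) F.zero (C₄-¬2-colorable ps 2≤S₁)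
critical-if-C₃-C₄-or-P₄ S ps S₀≡1 2≤S₁ G loopless (inj₂ (inj₂ iso)) =
  critical-if-isomorphic S ps G _ loopless iso (P₄-has-isolating S S₀≡1) F.zero (P₄-¬2-colorable ps 2≤S₁)

SymmetricMatrix₃ : Bool → Bool → Bool → Fin 3 → Fin 3 → Bool
SymmetricMatrix₃ p q r i j = lookup (lookup (
  (false ∷ p ∷ q ∷ []) ∷
  (p ∷ false ∷ r ∷ []) ∷
  (q ∷ r ∷ false ∷ []) ∷ []) i) j

SymmetricMatrix₄ : Bool → Bool → Bool → Bool → Bool → Bool → Fin 4 → Fin 4 → Bool
SymmetricMatrix₄ p q r s t u i j = lookup (lookup (
  (false ∷ p ∷ q ∷ r ∷ []) ∷
  (p ∷ false ∷ s ∷ t ∷ []) ∷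
  (q ∷ s ∷ false ∷ u ∷ []) ∷
  (r ∷ t ∷ u ∷ false ∷ []) ∷ []) i) j

triangle-pattern : ∀ i j → SymmetricMatrix₃ true true true i j ≡ cycleG 3 i j
triangle-pattern = toWitness {a? = FP.all? λ i → FP.all? λ j →
  SymmetricMatrix₃ true true true i j B.≟ cycleG 3 i j} _

path₃-pattern : ∀ i j → SymmetricMatrix₃ true false true i j ≡ pathG 3 i j
path₃-pattern = toWitness {a? = FP.all? λ i → FP.all? λ j →
  SymmetricMatrix₃ true false true i j B.≟ pathG 3 i j} _

path₃⊆pattern : ∀ q i j → pathG 3 i j ≡ true → SymmetricMatrix₃ true q true i j ≡ true
path₃⊆pattern true = toWitness {a? = FP.all? λ i → FP.all? λ j →
  (pathG 3 i j B.≟ true) →-dec (SymmetricMatrix₃ true true true i j B.≟ true)} _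
path₃⊆pattern false i j e = trans (path₃-pattern i j) e

cycle₄-pattern : ∀ i j → SymmetricMatrix₄ true false true true false true i j ≡ cycleG 4 i j
cycle₄-pattern = toWitness {a? = FP.all? λ i → FP.all? λ j →
  SymmetricMatrix₄ true false true true false true i j B.≟ cycleG 4 i j} _

path₄-pattern : ∀ i j → SymmetricMatrix₄ true false false true false true i j ≡ pathG 4 i j
path₄-pattern = toWitness {a? = FP.all? λ i → FP.all? λ j →
  SymmetricMatrix₄ true false false true false true i j B.≟ pathG 4 i j} _

path₄⊆pattern : ∀ r i j → pathG 4 i j ≡ true → SymmetricMatrix₄ true false r true false true i j ≡ true
path₄⊆pattern true i j e = trans (cycle₄-pattern i j) (P₄⊆C₄ i j e)
path₄⊆pattern false i j e = trans (path₄-pattern i j) e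

matrix₃-cong : ∀ {p p′ q q′ r r′} → p ≡ p′ → q ≡ q′ → r ≡ r′ →
  ∀ i j → SymmetricMatrix₃ p q r i j ≡ SymmetricMatrix₃ p′ q′ r′ i j
matrix₃-cong refl refl refl i j = refl

matrix₄-cong : ∀ {p p′ q q′ r r′ s s′ t t′ u u′} →
  p ≡ p′ → q ≡ q′ → r ≡ r′ → s ≡ s′ → t ≡ t′ → u ≡ u′ →
  ∀ i j → SymmetricMatrix₄ p q r s t u i j ≡ SymmetricMatrix₄ p′ q′ r′ s′ t′ u′ i j
matrix₄-cong refl refl refl refl refl refl i j = refl

module _ {n} {G : Graph n} (simple : IsSimple G) where
  private
    symmetric : Symmetric G
    symmetric = proj₁ simple
    loopless : Loopless G
    loopless = proj₂ simple

  induced₃ : ∀ a b c i j → let h = lookup (a ∷ b ∷ c ∷ []) in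
    G (h i) (h j) ≡ SymmetricMatrix₃ (G a b) (G a c) (G b c) i j
  induced₃ a b c F.zero F.zero = loopless a
  induced₃ a b c F.zero (F.suc F.zero) = refl
  induced₃ a b c F.zero (F.suc (F.suc F.zero)) = refl
  induced₃ a b c (F.suc F.zero) F.zero = symmetric b a
  induced₃ a b c (F.suc F.zero) (F.suc F.zero) = loopless b
  induced₃ a b c (F.suc F.zero) (F.suc (F.suc F.zero)) = refl
  induced₃ a b c (F.suc (F.suc F.zero)) F.zero = symmetric c a
  induced₃ a b c (F.suc (F.suc F.zero)) (F.suc F.zero) = symmetric c b
  induced₃ a b c (F.suc (F.suc F.zero)) (F.suc (F.suc F.zero)) = loopless c

  induced₄ : ∀ a b c d i j → let h = lookup (a ∷ b ∷ c ∷ d ∷ []) in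
    G (h i) (h j) ≡ SymmetricMatrix₄ (G a b) (G a c) (G a d) (G b c) (G b d) (G c d) i j
  induced₄ a b c d F.zero F.zero = loopless a
  induced₄ a b c d F.zero (F.suc F.zero) = refl
  induced₄ a b c d F.zero (F.suc (F.suc F.zero)) = refl
  induced₄ a b c d F.zero (F.suc (F.suc (F.suc F.zero))) = refl
  induced₄ a b c d (F.suc F.zero) F.zero = symmetric b a
  induced₄ a b c d (F.suc F.zero) (F.suc F.zero) = loopless b
  induced₄ a b c d (F.suc F.zero) (F.suc (F.suc F.zero)) = refl
  induced₄ a b c d (F.suc F.zero) (F.suc (F.suc (F.suc F.zero))) = refl
  induced₄ a b c d (F.suc (F.suc F.zero)) F.zero = symmetric c a
  induced₄ a b c d (F.suc (F.suc F.zero)) (F.suc F.zero) = symmetric c b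
  induced₄ a b c d (F.suc (F.suc F.zero)) (F.suc (F.suc F.zero)) = loopless c
  induced₄ a b c d (F.suc (F.suc F.zero)) (F.suc (F.suc (F.suc F.zero))) = refl
  induced₄ a b c d (F.suc (F.suc (F.suc F.zero))) F.zero = symmetric d a
  induced₄ a b c d (F.suc (F.suc (F.suc F.zero))) (F.suc F.zero) = symmetric d b
  induced₄ a b c d (F.suc (F.suc (F.suc F.zero))) (F.suc (F.suc F.zero)) = symmetric d c
  induced₄ a b c d (F.suc (F.suc (F.suc F.zero))) (F.suc (F.suc (F.suc F.zero))) = loopless d

  unique₃ : ∀ {a b c} → G a b ≡ true → a ≢ c → G b c ≡ true → Unique (a ∷ b ∷ c ∷ [])
  unique₃ ab a≢c bc =
    (edge⇒≢ loopless ab ∷ a≢c ∷ []) ∷ (edge⇒≢ loopless bc ∷ []) ∷ [] ∷ []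

  unique₄ : ∀ {a b c d} → G a b ≡ true → a ≢ c → a ≢ d → G b c ≡ true → b ≢ d → G c d ≡ true →
    Unique (a ∷ b ∷ c ∷ d ∷ [])
  unique₄ ab a≢c a≢d bc b≢d cd =
    (edge⇒≢ loopless ab ∷ a≢c ∷ a≢d ∷ []) ∷ (edge⇒≢ loopless bc ∷ b≢d ∷ []) ∷
    (edge⇒≢ loopless cd ∷ []) ∷ [] ∷ []

  critical⇒isomorphic-to-induced : ∀ S {k} (H : Graph k) → Is3ChiSCritical S G →
    (vs : Vec (Fin n) k) → Unique vs → IsHom H G (lookup vs) → ¬ HasPackingColoring S H 2 → (K : Graph k) →
    (∀ i j → G (lookup vs i) (lookup vs j) ≡ K i j) → Isomorphic G K
  critical⇒isomorphic-to-induced S H critical vs unique hom ¬2col K edges =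
    isomorphic-from-enumeration G K (lookup vs) injective
      (critical⇒embedding-surjective S G H critical (lookup vs) (injective , hom) ¬2col) edges
    where
    injective : Injective _≡_ _≡_ (lookup vs)
    injective {i} {j} = lookup-injective unique i j

-- The case 2 ≤ s₁

Path₃ : ∀ {n} → Graph n → Set
Path₃ {n} G = Σ (Fin n) λ a → Σ (Fin n) λ b → Σ (Fin n) λ c → a ≢ c × G a b ≡ true × G b c ≡ true

path₃? : ∀ {n} (G : Graph n) → Dec (Path₃ G)
path₃? G = FP.any? λ a → FP.any? λ b → FP.any? λ c →
  ¬? (a F.≟ c) ×-dec (G a b B.≟ true) ×-dec (G b c B.≟ true)

-- Without a path on three vertices every vertex has at most one neighbor;
-- color a vertex by whether that neighbor has a smaller index.
module MaxDegreeOne {n} {G : Graph n} (symmetric : Symmetric G) (loopless : Loopless G) (no-path : ¬ Path₃ G)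
  where

  neighbor-unique : ∀ {v a b} → G v a ≡ true → G v b ≡ true → a ≡ b
  neighbor-unique {v} {a} {b} va vb with a F.≟ b
  ... | yes a≡b = a≡b
  ... | no a≢b = ⊥-elim (no-path (a , v , b , a≢b , trans (symmetric a v) va , vb))

  reach-inv : ∀ {u v d} → Reach G u v d → u ≡ v ⊎ G u v ≡ true
  reach-inv here = inj₁ refl
  reach-inv {u} (step {w = w} uw r) with reach-inv r
  ... | inj₁ refl = inj₂ uw
  ... | inj₂ wv = inj₁ (neighbor-unique (trans (symmetric w u) uw) wv)

  lower-neighbor? : ∀ v → Dec (Σ (Fin n) λ w → toℕ w < toℕ v × G v w ≡ true)
  lower-neighbor? v = FP.any? λ w → (toℕ w <? toℕ v) ×-dec (G v w B.≟ true)

  color : Fin n → Fin 2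
  color v with lower-neighbor? v
  ... | yes _ = F.suc F.zero
  ... | no _ = F.zero

  color-differs-upward : ∀ {u v} → G u v ≡ true → toℕ u < toℕ v → color u ≢ color v
  color-differs-upward {u} {v} uv u<v eq with lower-neighbor? u | lower-neighbor? v
  ... | _ | no none = none (u , u<v , trans (symmetric v u) uv)
  ... | yes (w , w<u , uw) | yes _ with neighbor-unique uv uw
  ...   | refl = <-asym u<v w<u
  color-differs-upward _ _ () | no _ | yes _

  color-proper : ∀ {u v} → G u v ≡ true → color u ≢ color v
  color-proper {u} {v} uv with <-cmp (toℕ u) (toℕ v)
  ... | tri< u<v _ _ = color-differs-upward uv u<v
  ... | tri≈ _ u≡v _ = ⊥-elim (edge⇒≢ loopless uv (FP.toℕ-injective u≡v))
  ... | tri> _ _ v<u = λ eq → color-differs-upward (trans (symmetric v u) uv) v<u (sym eq)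

  2-colorable : ∀ S → HasPackingColoring S G 2
  2-colorable S = color , λ u v u≢v eq r → [ u≢v , (λ uv → color-proper uv eq) ]′ (reach-inv r)

C₃-or-P₃-if-critical : ∀ S → IsPackingSeq S → 2 ≤ S 0 → ∀ {n} (G : Graph n) → IsSimple G →
  Is3ChiSCritical S G → Isomorphic G (cycleG 3) ⊎ Isomorphic G (pathG 3)
C₃-or-P₃-if-critical S ps 2≤S₀ G simple critical with path₃? G
... | no none = ⊥-elim (chiS≡3⇒¬2-colorable {S} (proj₁ critical)
                   (MaxDegreeOne.2-colorable (proj₁ simple) (proj₂ simple) none S))
... | yes (a , b , c , a≢c , ab , bc) = classify (G a c) refl
  where
  edges : ∀ {q} → G a c ≡ q → ∀ i j →
    G (lookup (a ∷ b ∷ c ∷ []) i) (lookup (a ∷ b ∷ c ∷ []) j) ≡ SymmetricMatrix₃ true q true i j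
  edges ac i j = trans (induced₃ simple a b c i j) (matrix₃-cong ab ac bc i j)
  isomorphic : ∀ {q} → G a c ≡ q → (K : Graph 3) →
    (∀ i j → SymmetricMatrix₃ true q true i j ≡ K i j) → Isomorphic G K
  isomorphic ac K shape =
    critical⇒isomorphic-to-induced simple S (pathG 3) critical _ (unique₃ simple ab a≢c bc)
    (λ i j e → trans (edges refl i j) (path₃⊆pattern _ i j e)) (P₃-¬2-colorable ps 2≤S₀) K
    (λ i j → trans (edges ac i j) (shape i j))
  classify : ∀ q → G a c ≡ q → Isomorphic G (cycleG 3) ⊎ Isomorphic G (pathG 3)
  classify true ac = inj₁ (isomorphic ac (cycleG 3) triangle-pattern)
  classify false ac = inj₂ (isomorphic ac (pathG 3) path₃-pattern)

-- The case s₁ = 1 < s₂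

Triangle : ∀ {n} → Graph n → Set
Triangle {n} G = Σ (Fin n) λ a → Σ (Fin n) λ b → Σ (Fin n) λ c →
  a ≢ c × G a b ≡ true × G b c ≡ true × G c a ≡ true

triangle? : ∀ {n} (G : Graph n) → Dec (Triangle G)
triangle? G = FP.any? λ a → FP.any? λ b → FP.any? λ c →
  ¬? (a F.≟ c) ×-dec (G a b B.≟ true) ×-dec (G b c B.≟ true) ×-dec (G c a B.≟ true)

Path₄ : ∀ {n} → Graph n → Set
Path₄ {n} G = Σ (Fin n) λ a → Σ (Fin n) λ b → Σ (Fin n) λ c → Σ (Fin n) λ d →
  a ≢ c × b ≢ d × a ≢ d × G a b ≡ true × G b c ≡ true × G c d ≡ true

path₄? : ∀ {n} (G : Graph n) → Dec (Path₄ G)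
path₄? G = FP.any? λ a → FP.any? λ b → FP.any? λ c → FP.any? λ d →
  ¬? (a F.≟ c) ×-dec ¬? (b F.≟ d) ×-dec ¬? (a F.≟ d) ×-dec
  (G a b B.≟ true) ×-dec (G b c B.≟ true) ×-dec (G c d B.≟ true)

-- A graph without triangles and paths on four vertices is a disjoint union of stars: color the
-- centers with the second color (two centers are never within distance 2) and the leaves with the first.
module StarForest {n} {G : Graph n} (symmetric : Symmetric G) (loopless : Loopless G)
  (no-triangle : ¬ Triangle G) (no-path : ¬ Path₄ G) where

  Branching : Fin n → Set
  Branching v = Σ (Fin n) λ a → Σ (Fin n) λ b → a ≢ b × G v a ≡ true × G v b ≡ true

  branching? : ∀ v → Dec (Branching v)
  branching? v = FP.any? λ a → FP.any? λ b → ¬? (a F.≟ b) ×-dec (G v a B.≟ true) ×-dec (G v b B.≟ true)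

  -- In a single-edge component the endpoint with the smaller index is the center.
  Center : Fin n → Set
  Center v = Branching v ⊎ Σ (Fin n) λ w → G v w ≡ true × ¬ Branching w × toℕ v < toℕ w

  center? : ∀ v → Dec (Center v)
  center? v = branching? v ⊎-dec FP.any? λ w → (G v w B.≟ true) ×-dec ¬? (branching? w) ×-dec (toℕ v <? toℕ w)

  other-neighbor : ∀ {u} → Branching u → ∀ z → Σ (Fin n) λ x → x ≢ z × G u x ≡ true
  other-neighbor (a , b , a≢b , ua , ub) z with a F.≟ z
  ... | no a≢z = a , a≢z , ua
  ... | yes refl = b , (λ b≡a → a≢b (sym b≡a)) , ub

  branching-ends-no-path₃ : ∀ {u w v} → G u w ≡ true → G w v ≡ true → u ≢ v → ¬ Branching u
  branching-ends-no-path₃ {u} {w} {v} uw wv u≢v branching with other-neighbor branching w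
  ... | x , x≢w , ux with x F.≟ v
  ...   | yes refl = no-triangle (u , w , x , u≢v , uw , wv , trans (symmetric x u) ux)
  ...   | no x≢v = no-path (x , u , w , v , x≢w , u≢v , x≢v , trans (symmetric x u) ux , uw , wv)

  branching-not-adjacent : ∀ {u v} → G u v ≡ true → Branching u → ¬ Branching v
  branching-not-adjacent {u} {v} uv bu bv with other-neighbor bu v | other-neighbor bv u
  ... | x , x≢v , ux | y , y≢u , vy with x F.≟ y
  ...   | yes refl = no-triangle (x , u , v , x≢v , trans (symmetric x u) ux , uv , vy)
  ...   | no x≢y =
    no-path (x , u , v , y , x≢v , (λ u≡y → y≢u (sym u≡y)) , x≢y , trans (symmetric x u) ux , uv , vy)

  center-towards : ∀ {u v} → G u v ≡ true → Center u → Branching u ⊎ (¬ Branching v × toℕ u < toℕ v)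
  center-towards _ (inj₁ bu) = inj₁ bu
  center-towards {u} {v} uv (inj₂ (w , uw , ¬bw , u<w)) with w F.≟ v
  ... | yes refl = inj₂ (¬bw , u<w)
  ... | no w≢v = inj₁ (w , v , w≢v , uw , uv)

  centers-not-adjacent : ∀ {u v} → G u v ≡ true → Center u → ¬ Center v
  centers-not-adjacent {u} {v} uv cu cv with center-towards uv cu | center-towards (trans (symmetric v u) uv) cv
  ... | inj₁ bu | inj₁ bv = branching-not-adjacent uv bu bv
  ... | inj₁ bu | inj₂ (¬bu , _) = ¬bu bu
  ... | inj₂ (¬bv , _) | inj₁ bv = ¬bv bv
  ... | inj₂ (_ , u<v) | inj₂ (_ , v<u) = <-asym u<v v<u

  leaves-not-adjacent : ∀ {u v} → G u v ≡ true → ¬ Center u → Center v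
  leaves-not-adjacent {u} {v} uv ¬cu with branching? u | branching? v
  ... | yes bu | _ = ⊥-elim (¬cu (inj₁ bu))
  ... | no _ | yes bv = inj₁ bv
  ... | no ¬bu | no ¬bv with <-cmp (toℕ u) (toℕ v)
  ...   | tri< u<v _ _ = ⊥-elim (¬cu (inj₂ (v , uv , ¬bv , u<v)))
  ...   | tri≈ _ u≡v _ = ⊥-elim (edge⇒≢ loopless uv (FP.toℕ-injective u≡v))
  ...   | tri> _ _ v<u = inj₂ (u , trans (symmetric v u) uv , ¬bu , v<u)

  center-no-path₃ : ∀ {u w v} → Center u → G u w ≡ true → G w v ≡ true → u ≢ v → ⊥
  center-no-path₃ (inj₁ bu) uw wv u≢v = branching-ends-no-path₃ uw wv u≢v bu
  center-no-path₃ {u} {w} {v} (inj₂ (w′ , uw′ , ¬bw′ , _)) uw wv u≢v with w′ F.≟ w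
  ... | yes refl = ¬bw′ (u , v , u≢v , trans (symmetric w′ u) uw , wv)
  ... | no w′≢w = branching-ends-no-path₃ uw wv u≢v (w′ , w , w′≢w , uw′ , uw)

  reach-inv : ∀ {u v d} → Reach G u v d →
    u ≡ v ⊎ G u v ≡ true ⊎ Σ (Fin n) λ w → G u w ≡ true × G w v ≡ true
  reach-inv here = inj₁ refl
  reach-inv {u} {v} (step {w = w} uw r) with reach-inv r
  ... | inj₁ refl = inj₂ (inj₁ uw)
  ... | inj₂ (inj₁ wv) = inj₂ (inj₂ (w , uw , wv))
  ... | inj₂ (inj₂ (z , wz , zv)) with u F.≟ z | u F.≟ v | w F.≟ v
  ...   | yes refl | _ | _ = inj₂ (inj₁ zv)
  ...   | no _ | yes u≡v | _ = inj₁ u≡v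
  ...   | no _ | no _ | yes refl = inj₂ (inj₁ uw)
  ...   | no u≢z | no u≢v | no w≢v = ⊥-elim (no-path (u , w , z , v , u≢z , w≢v , u≢v , uw , wz , zv))

  color : Fin n → Fin 2
  color v with center? v
  ... | yes _ = F.suc F.zero
  ... | no _ = F.zero

  color-proper : ∀ {u v} → G u v ≡ true → color u ≢ color v
  color-proper {u} {v} uv eq with center? u | center? v
  ... | yes cu | yes cv = centers-not-adjacent uv cu cv
  ... | no ¬cu | no ¬cv = ¬cv (leaves-not-adjacent uv ¬cu)
  color-proper _ () | yes _ | no _
  color-proper _ () | no _ | yes _

  leaf-color : ∀ {u} → ¬ Center u → color u ≡ F.zero
  leaf-color {u} ¬cu with center? u
  ... | yes cu = ⊥-elim (¬cu cu)
  ... | no _ = refl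

  2-colorable : ∀ S → S 0 ≡ 1 → HasPackingColoring S G 2
  2-colorable S S₀≡1 = color , ok
    where
    ok : IsPackingColoring S G color
    ok u v u≢v eq r = by-role (center? u)
      where
      by-role : Dec (Center u) → ⊥
      by-role (yes cu) with reach-inv r
      ... | inj₁ u≡v = u≢v u≡v
      ... | inj₂ (inj₁ uv) = color-proper uv eq
      ... | inj₂ (inj₂ (w , uw , wv)) = center-no-path₃ cu uw wv u≢v
      by-role (no ¬cu)
        with reach-unit S (leaf-color ¬cu) S₀≡1 r
      ... | inj₁ u≡v = u≢v u≡v
      ... | inj₂ uv = color-proper uv eq

C₃-C₄-or-P₄-if-critical : ∀ S → IsPackingSeq S → S 0 ≡ 1 → 2 ≤ S 1 →
  ∀ {n} (G : Graph n) → IsSimple G →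
  Is3ChiSCritical S G → Isomorphic G (cycleG 3) ⊎ Isomorphic G (cycleG 4) ⊎ Isomorphic G (pathG 4)
C₃-C₄-or-P₄-if-critical S ps S₀≡1 2≤S₁ G simple critical with triangle? G
... | yes (a , b , c , a≢c , ab , bc , ca) =
  inj₁ (critical⇒isomorphic-to-induced simple S (cycleG 3) critical _ (unique₃ simple ab a≢c bc)
          (λ i j e → trans (edges i j) e) (C₃-¬2-colorable ps) (cycleG 3) edges)
  where
  edges : ∀ i j → G (lookup (a ∷ b ∷ c ∷ []) i) (lookup (a ∷ b ∷ c ∷ []) j) ≡ cycleG 3 i j
  edges i j = trans (induced₃ simple a b c i j)
    (trans (matrix₃-cong ab (trans (proj₁ simple a c) ca) bc i j) (triangle-pattern i j))
... | no no-triangle with path₄? G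
...   | no no-path = ⊥-elim (chiS≡3⇒¬2-colorable {S} (proj₁ critical)
                        (StarForest.2-colorable (proj₁ simple) (proj₂ simple) no-triangle no-path S S₀≡1))
...   | yes (a , b , c , d , a≢c , b≢d , a≢d , ab , bc , cd) = inj₂ (classify (G a d) refl)
  where
  chord-free : ∀ {x y z} → x ≢ z → G x y ≡ true → G y z ≡ true → G x z ≡ false
  chord-free {x} {y} {z} x≢z xy yz = ¬-not λ xz →
    no-triangle (x , y , z , x≢z , xy , yz , trans (proj₁ simple z x) xz)
  edges : ∀ {r} → G a d ≡ r → ∀ i j → let h = lookup (a ∷ b ∷ c ∷ d ∷ []) in
    G (h i) (h j) ≡ SymmetricMatrix₄ true false r true false true i j
  edges ad i j = trans (induced₄ simple a b c d i j)
    (matrix₄-cong ab (chord-free a≢c ab bc) ad bc (chord-free b≢d bc cd) cd i j)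
  isomorphic : ∀ {r} → G a d ≡ r → (K : Graph 4) →
    (∀ i j → SymmetricMatrix₄ true false r true false true i j ≡ K i j) → Isomorphic G K
  isomorphic ad K shape =
    critical⇒isomorphic-to-induced simple S (pathG 4) critical _ (unique₄ simple ab a≢c a≢d bc b≢d cd)
    (λ i j e → trans (edges refl i j) (path₄⊆pattern _ i j e)) (P₄-¬2-colorable ps 2≤S₁) K
    (λ i j → trans (edges ad i j) (shape i j))
  classify : ∀ r → G a d ≡ r → Isomorphic G (cycleG 4) ⊎ Isomorphic G (pathG 4)
  classify true ad = inj₁ (isomorphic ad (cycleG 4) cycle₄-pattern)
  classify false ad = inj₂ (isomorphic ad (pathG 4) path₄-pattern)

-- The case s₁ = s₂ = 1: signed graphs

∨-introˡ : ∀ x y → T x → T (x ∨ y)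
∨-introˡ x y tx = Equivalence.from (T-∨ {x} {y}) (inj₁ tx)

∨-introʳ : ∀ x y → T y → T (x ∨ y)
∨-introʳ x y ty = Equivalence.from (T-∨ {x} {y}) (inj₂ ty)

∨-elim : ∀ x y → T (x ∨ y) → T x ⊎ T y
∨-elim x y = Equivalence.to (T-∨ {x} {y})

∧-intro : ∀ x y → T x → T y → T (x ∧ y)
∧-intro x y tx ty = Equivalence.from (T-∧ {x} {y}) (tx , ty)

∧-elim : ∀ x y → T (x ∧ y) → T x × T y
∧-elim x y = Equivalence.to (T-∧ {x} {y})

SignedGraph : ℕ → Set
SignedGraph n = Fin n → Fin n → Bool → Bool

SignedAdjacent : ∀ {n} → SignedGraph n → Fin n → Fin n → Bool → Set
SignedAdjacent R u w s = T (R u w s) ⊎ T (R w u s)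

data SignedWalk {n} (R : SignedGraph n) : Fin n → Fin n → Bool → Set where
  [] : ∀ {u} → SignedWalk R u u false
  _∷_ : ∀ {u w v s t} → SignedAdjacent R u w s → SignedWalk R w v t → SignedWalk R u v (s xor t)

Balanced : ∀ {n} → SignedGraph n → (Fin n → Bool) → Set
Balanced R c = ∀ a b s → T (R a b s) → c a xor c b ≡ s

-- Deleting vertex 0 and replacing every signed path a — 0 — b by an edge a — b of the combined sign
-- preserves both balance and odd closed walks.
module EliminateFirst {n} (R : SignedGraph (suc n)) where

  ToZero : Fin n → Bool → Bool
  ToZero a σ = R F.zero (F.suc a) σ ∨ R (F.suc a) F.zero σ

  Reduced : SignedGraph n
  Reduced a b s =
    R (F.suc a) (F.suc b) s ∨ ((ToZero a false ∧ ToZero b s) ∨ (ToZero a true ∧ ToZero b (not s)))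

  reduced-intro : ∀ {a b} σ τ → T (ToZero a σ) → T (ToZero b τ) → T (Reduced a b (σ xor τ))
  reduced-intro {a} {b} false τ za zb =
    ∨-introʳ (R (F.suc a) (F.suc b) τ) _ (∨-introˡ _ _ (∧-intro _ _ za zb))
  reduced-intro {a} {b} true τ za zb =
    ∨-introʳ (R (F.suc a) (F.suc b) (not τ)) _ (∨-introʳ (ToZero a false ∧ _) _
      (∧-intro _ _ za (subst (λ x → T (ToZero b x)) (sym (not-involutive τ)) zb)))

  reduced-elim : ∀ {a b s} → T (Reduced a b s) → T (R (F.suc a) (F.suc b) s) ⊎
    Σ Bool λ σ → Σ Bool λ τ → T (ToZero a σ) × T (ToZero b τ) × σ xor τ ≡ s
  reduced-elim {a} {b} {s} e with ∨-elim (R (F.suc a) (F.suc b) s) _ e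
  ... | inj₁ direct = inj₁ direct
  ... | inj₂ via with ∨-elim (ToZero a false ∧ ToZero b s) _ via
  ...   | inj₁ e₁ = let za , zb = ∧-elim (ToZero a false) _ e₁ in inj₂ (false , s , za , zb , refl)
  ...   | inj₂ e₂ = let za , zb = ∧-elim (ToZero a true) _ e₂ in inj₂ (true , not s , za , zb , not-involutive s)

  via-zero : ∀ {a b v t} σ τ → T (ToZero a σ) → T (ToZero b τ) → SignedWalk R (F.suc b) v t →
    SignedWalk R (F.suc a) v ((σ xor τ) xor t)
  via-zero {t = t} σ τ za zb w =
    subst (SignedWalk R _ _) (sym (xor-assoc σ τ t)) (swap (∨-elim _ _ za) ∷ (∨-elim _ _ zb ∷ w))

  lift-step : ∀ {u w v s t} → SignedAdjacent Reduced u w s → SignedWalk R (F.suc w) v t →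
    SignedWalk R (F.suc u) v (s xor t)
  lift-step (inj₁ e) rest with reduced-elim e
  ... | inj₁ direct = inj₁ direct ∷ rest
  ... | inj₂ (σ , τ , za , zb , refl) = via-zero σ τ za zb rest
  lift-step {t = t} (inj₂ e) rest with reduced-elim e
  ... | inj₁ direct = inj₂ direct ∷ rest
  ... | inj₂ (σ , τ , zw , zu , refl) =
    subst (λ s → SignedWalk R _ _ (s xor t)) (xor-comm τ σ) (via-zero τ σ zu zw rest)

  lift : ∀ {u v t} → SignedWalk Reduced u v t → SignedWalk R (F.suc u) (F.suc v) t
  lift [] = []
  lift (e ∷ w) = lift-step e (lift w)

  -- Vertex 0 gets the color forced by any one of its neighbors; balance of the reduced graph
  -- makes that choice consistent with all the others.
  extend : ∀ c → Balanced Reduced c → ¬ T (R F.zero F.zero true) → Σ (Fin (suc n) → Bool) (Balanced R)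
  extend c balanced no-odd-loop = c₀ VF.∷ c , balanced′
    where
    neighbor? : Dec (Σ (Fin n) λ a → Σ Bool λ σ → T (ToZero a σ))
    neighbor? = FP.any? λ a → map′ (λ { (inj₁ z) → false , z ; (inj₂ z) → true , z })
      (λ { (false , z) → inj₁ z ; (true , z) → inj₂ z }) (T? (ToZero a false) ⊎-dec T? (ToZero a true))
    c₀ : Bool
    c₀ with neighbor?
    ... | yes (a , σ , _) = c a xor σ
    ... | no _ = false
    from-zero : ∀ b s → T (ToZero b s) → c₀ xor c b ≡ s
    from-zero b s zb with neighbor?
    ... | no none = ⊥-elim (none (b , s , zb))
    ... | yes (a , σ , za) = begin
      (c a xor σ) xor c b ≡⟨ xor-assoc (c a) σ (c b) ⟩
      c a xor (σ xor c b) ≡⟨ cong (c a xor_) (xor-comm σ (c b)) ⟩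
      c a xor (c b xor σ) ≡⟨ sym (xor-assoc (c a) (c b) σ) ⟩
      (c a xor c b) xor σ ≡⟨ cong (_xor σ) (balanced a b (σ xor s) (reduced-intro σ s za zb)) ⟩
      (σ xor s) xor σ     ≡⟨ xor-comm (σ xor s) σ ⟩
      σ xor (σ xor s)     ≡⟨ sym (xor-assoc σ σ s) ⟩
      (σ xor σ) xor s     ≡⟨ cong (_xor s) (xor-same σ) ⟩
      s                   ∎
      where open ≡-Reasoning
    balanced′ : Balanced R (c₀ VF.∷ c)
    balanced′ F.zero F.zero false _ = xor-same c₀
    balanced′ F.zero F.zero true loop = ⊥-elim (no-odd-loop loop)
    balanced′ F.zero (F.suc b) s e = from-zero b s (∨-introˡ _ _ e)
    balanced′ (F.suc a) F.zero s e =
      trans (xor-comm (c a) c₀) (from-zero a s (∨-introʳ (R F.zero (F.suc a) s) _ e))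
    balanced′ (F.suc a) (F.suc b) s e = balanced a b s (∨-introˡ _ _ e)

balanced-or-odd-closed-walk : ∀ n (R : SignedGraph n) →
  Σ (Fin n → Bool) (Balanced R) ⊎ Σ (Fin n) λ u → SignedWalk R u u true
balanced-or-odd-closed-walk zero R = inj₁ ((λ ()) , λ ())
balanced-or-odd-closed-walk (suc n) R with T? (R F.zero F.zero true)
... | yes loop = inj₂ (F.zero , inj₁ loop ∷ [])
... | no no-odd-loop with balanced-or-odd-closed-walk n (EliminateFirst.Reduced R)
...   | inj₂ (u , w) = inj₂ (F.suc u , EliminateFirst.lift R w)
...   | inj₁ (c , balanced) = inj₁ (EliminateFirst.extend R c balanced no-odd-loop)

isOdd : ℕ → Bool
isOdd zero = false
isOdd (suc n) = not (isOdd n)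

isOdd-+ : ∀ a b → isOdd (a + b) ≡ isOdd a xor isOdd b
isOdd-+ zero b = refl
isOdd-+ (suc a) b = trans (cong not (isOdd-+ a b)) (not-distribˡ-xor (isOdd a) (isOdd b))

record ClosedWalk {n} (G : Graph n) : Set where
  constructor closedWalk
  field
    length : ℕ
    vertex : ℕ → Fin n
    adjacent : ∀ i → i < length → G (vertex i) (vertex (suc i)) ≡ true
    closed : vertex length ≡ vertex 0

OddClosedWalk : ∀ {n} → Graph n → Set
OddClosedWalk G = Σ (ClosedWalk G) λ W → isOdd (ClosedWalk.length W) ≡ true

toBool : Fin 2 → Bool
toBool F.zero = false
toBool (F.suc F.zero) = true

toBool-≢ : ∀ x y → x ≢ y → toBool y ≡ not (toBool x)
toBool-≢ F.zero F.zero x≢y = ⊥-elim (x≢y refl)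
toBool-≢ F.zero (F.suc F.zero) _ = refl
toBool-≢ (F.suc F.zero) F.zero _ = refl
toBool-≢ (F.suc F.zero) (F.suc F.zero) x≢y = ⊥-elim (x≢y refl)

fromBool : Bool → Fin 2
fromBool false = F.zero
fromBool true = F.suc F.zero

fromBool-injective : ∀ {x y} → fromBool x ≡ fromBool y → x ≡ y
fromBool-injective {false} {false} _ = refl
fromBool-injective {true} {true} _ = refl

oddClosedWalk⇒¬2-colorable : ∀ {S} → IsPackingSeq S → ∀ {n} {G : Graph n} → Loopless G → OddClosedWalk G →
  ¬ HasPackingColoring S G 2
oddClosedWalk⇒¬2-colorable ps {G = G} loopless (closedWalk ℓ f adjacent closed , odd) (c , ok) =
  not-¬ refl (begin
    b 0                 ≡⟨ cong (λ v → toBool (c v)) closed ⟨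
    b ℓ                 ≡⟨ alternates ℓ ≤-refl ⟩
    b 0 xor isOdd ℓ     ≡⟨ cong (b 0 xor_) odd ⟩
    b 0 xor true        ≡⟨ xor-comm (b 0) true ⟩
    not (b 0)           ∎)
  where
  open ≡-Reasoning
  b : ℕ → Bool
  b i = toBool (c (f i))
  alternates : ∀ i → i ≤ ℓ → b i ≡ b 0 xor isOdd i
  alternates zero _ = sym (xor-identityʳ (b 0))
  alternates (suc i) i<ℓ = begin
    b (suc i)                 ≡⟨ toBool-≢ _ _ (packingColoring-proper ps loopless ok _ _ (adjacent i i<ℓ)) ⟩
    not (b i)                 ≡⟨ cong not (alternates i (<⇒≤ i<ℓ)) ⟩
    not (b 0 xor isOdd i)     ≡⟨ not-distribʳ-xor (b 0) (isOdd i) ⟩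
    b 0 xor isOdd (suc i)     ∎

EdgeSigns : ∀ {n} → Graph n → SignedGraph n
EdgeSigns G a b s = G a b ∧ s

edgeSigns-adjacent : ∀ {n} {G : Graph n} → IsSimple G → ∀ {u w s} → SignedAdjacent (EdgeSigns G) u w s →
  G u w ≡ true × s ≡ true
edgeSigns-adjacent {G = G} _ {u} {w} {s} (inj₁ e) =
  let e₁ , e₂ = ∧-elim (G u w) s e in Equivalence.to T-≡ e₁ , Equivalence.to T-≡ e₂
edgeSigns-adjacent {G = G} (symmetric , _) {u} {w} {s} (inj₂ e) =
  let e₁ , e₂ = ∧-elim (G w u) s e in trans (symmetric u w) (Equivalence.to T-≡ e₁) , Equivalence.to T-≡ e₂

signedWalk⇒walk : ∀ {n} {G : Graph n} → IsSimple G → ∀ {u v p} → SignedWalk (EdgeSigns G) u v p →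
  Σ ℕ λ ℓ → Σ (ℕ → Fin n) λ f →
    f 0 ≡ u × f ℓ ≡ v × (∀ i → i < ℓ → G (f i) (f (suc i)) ≡ true) × isOdd ℓ ≡ p
signedWalk⇒walk simple {u} [] = 0 , (λ _ → u) , refl , refl , (λ _ ()) , refl
signedWalk⇒walk {n} {G} simple {u} (_∷_ {w = w} {s = s} {t = t} uw rest) with signedWalk⇒walk simple rest
... | ℓ , f , f₀ , f-end , adjacent , odd =
  suc ℓ , f′ , refl , f-end , adjacent′ , trans (cong not odd) (sym (odd-sign (proj₂ uw-and-sign)))
  where
  uw-and-sign : G u w ≡ true × s ≡ true
  uw-and-sign = edgeSigns-adjacent simple uw
  odd-sign : s ≡ true → s xor t ≡ not t
  odd-sign refl = refl
  f′ : ℕ → Fin n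
  f′ zero = u
  f′ (suc i) = f i
  adjacent′ : ∀ i → i < suc ℓ → G (f′ i) (f′ (suc i)) ≡ true
  adjacent′ zero _ = trans (cong (G u) f₀) (proj₁ uw-and-sign)
  adjacent′ (suc i) (s≤s i<ℓ) = adjacent i i<ℓ

2-colorable-or-oddClosedWalk : ∀ S → S 0 ≡ 1 → S 1 ≡ 1 → ∀ {n} (G : Graph n) → IsSimple G →
  HasPackingColoring S G 2 ⊎ OddClosedWalk G
2-colorable-or-oddClosedWalk S S₀≡1 S₁≡1 {n} G simple with balanced-or-odd-closed-walk n (EdgeSigns G)
... | inj₂ (u , w) with signedWalk⇒walk simple w
...   | ℓ , f , f₀ , f-end , adjacent , odd = inj₂ (closedWalk ℓ f adjacent (trans f-end (sym f₀)) , odd)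
2-colorable-or-oddClosedWalk S S₀≡1 S₁≡1 {n} G simple | inj₁ (c , balanced) =
  inj₁ ((λ v → fromBool (c v)) , ok)
  where
  S-color≡1 : ∀ x → S (toℕ (fromBool x)) ≡ 1
  S-color≡1 false = S₀≡1
  S-color≡1 true = S₁≡1
  ok : IsPackingColoring S G (λ v → fromBool (c v))
  ok u v u≢v eq r with reach-unit S refl (S-color≡1 (c u)) r
  ... | inj₁ u≡v = u≢v u≡v
  ... | inj₂ uv = false≢true (begin
      false         ≡⟨ xor-same (c u) ⟨
      c u xor c u   ≡⟨ cong (c u xor_) (fromBool-injective eq) ⟩
      c u xor c v   ≡⟨ balanced u v true (Equivalence.from T-∧ (Equivalence.from T-≡ uv , _)) ⟩
      true          ∎)
    where open ≡-Reasoning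

oddClosedWalk-into-deletion : ∀ {m} {G : Graph (suc m)} w (W : OddClosedWalk G) →
  (∀ i → i < ClosedWalk.length (proj₁ W) → ClosedWalk.vertex (proj₁ W) i ≢ w) →
  OddClosedWalk (deleteVertex G w)
oddClosedWalk-into-deletion {m} {G} w (closedWalk ℓ f adjacent closed , odd) avoids =
  closedWalk ℓ f′ adjacent′ closed′ , odd
  where
  avoids′ : ∀ i → i ≤ ℓ → w ≢ f i
  avoids′ i i≤ℓ w≡fi with m≤n⇒m<n∨m≡n i≤ℓ
  ... | inj₁ i<ℓ = avoids i i<ℓ (sym w≡fi)
  ... | inj₂ refl = avoids 0 (positive ℓ odd) (sym (trans w≡fi closed))
    where
    positive : ∀ ℓ → isOdd ℓ ≡ true → 0 < ℓ
    positive (suc _) _ = s≤s z≤n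
  f′ : ℕ → Fin m
  f′ i with w F.≟ f i
  ... | yes _ = punchOut (avoids′ 0 z≤n)
  ... | no w≢fi = punchOut w≢fi
  f′-punchOut : ∀ i (w≢fi : w ≢ f i) → f′ i ≡ punchOut w≢fi
  f′-punchOut i w≢fi with w F.≟ f i
  ... | yes w≡fi = ⊥-elim (w≢fi w≡fi)
  ... | no _ = FP.punchOut-cong w refl
  punchIn-f′ : ∀ i → i ≤ ℓ → punchIn w (f′ i) ≡ f i
  punchIn-f′ i i≤ℓ =
    trans (cong (punchIn w) (f′-punchOut i (avoids′ i i≤ℓ))) (FP.punchIn-punchOut (avoids′ i i≤ℓ))
  adjacent′ : ∀ i → i < ℓ → deleteVertex G w (f′ i) (f′ (suc i)) ≡ true
  adjacent′ i i<ℓ = trans (cong₂ G (punchIn-f′ i (<⇒≤ i<ℓ)) (punchIn-f′ (suc i) i<ℓ)) (adjacent i i<ℓ)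
  closed′ : f′ ℓ ≡ f′ 0
  closed′ = trans (f′-punchOut ℓ (avoids′ ℓ ≤-refl))
    (trans (FP.punchOut-cong w closed) (sym (f′-punchOut 0 (avoids′ 0 z≤n))))

critical⇒oddClosedWalk-visits-all : ∀ S → IsPackingSeq S → ∀ {n} (G : Graph n) → IsSimple G →
  Is3ChiSCritical S G → (W : OddClosedWalk G) →
  ∀ v → Σ ℕ λ i → i < ClosedWalk.length (proj₁ W) × ClosedWalk.vertex (proj₁ W) i ≡ v
critical⇒oddClosedWalk-visits-all S ps {suc _} G simple critical W v
  with anyUpTo? (λ i → ClosedWalk.vertex (proj₁ W) i F.≟ v) (ClosedWalk.length (proj₁ W))
... | yes visit = visit
... | no miss = ⊥-elim (oddClosedWalk⇒¬2-colorable ps (λ _ → proj₂ simple _)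
        (oddClosedWalk-into-deletion v W (λ i i<ℓ e → miss (i , i<ℓ , e)))
        (deletionDrops⇒2-colorable {S} {G = G} v (proj₂ critical v)))

-- Shortest odd closed walks

record IsInducedCycle {n} {G : Graph n} (W : ClosedWalk G) : Set where
  constructor inducedCycle
  open ClosedWalk W
  field
    distinct : ∀ i j → i < j → j < length → vertex i ≢ vertex j
    chordless : ∀ i j → i < j → j < length → G (vertex i) (vertex j) ≡ true →
      j ≡ suc i ⊎ (i ≡ 0 × suc j ≡ length)

module Shortcuts {n} {G : Graph n} (W : ClosedWalk G) where
  open ClosedWalk W renaming (vertex to f)

  -- The closed walk f i, f (i+1), …, f (i+d), f i.
  loop : ∀ i d → i + d < length → G (f (i + d)) (f i) ≡ true → ClosedWalk G
  loop i d i+d<ℓ back = closedWalk (suc d) g adjacent′ closed′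
    where
    g : ℕ → Fin n
    g k with k ≤? d
    ... | yes _ = f (i + k)
    ... | no _ = f i
    g-inside : ∀ k → k ≤ d → g k ≡ f (i + k)
    g-inside k k≤d with k ≤? d
    ... | yes _ = refl
    ... | no k≰d = ⊥-elim (k≰d k≤d)
    g-end : g (suc d) ≡ f i
    g-end with suc d ≤? d
    ... | yes 1+d≤d = ⊥-elim (<-irrefl refl 1+d≤d)
    ... | no _ = refl
    adjacent′ : ∀ k → k < suc d → G (g k) (g (suc k)) ≡ true
    adjacent′ k (s≤s k≤d) with m≤n⇒m<n∨m≡n k≤d
    ... | inj₁ k<d = trans (cong₂ G (g-inside k k≤d) (trans (g-inside (suc k) k<d) (cong f (+-suc i k))))
                        (adjacent (i + k) (≤-<-trans (+-monoʳ-≤ i (<⇒≤ k<d)) i+d<ℓ))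
    ... | inj₂ refl = trans (cong₂ G (g-inside k ≤-refl) g-end) back
    closed′ : g (suc d) ≡ g 0
    closed′ = trans g-end (trans (cong f (sym (+-identityʳ i))) (sym (g-inside 0 z≤n)))

  -- The closed walk f 0, …, f i, f p, f (p+1), …, f length.
  bypass : ∀ i p r → i < p → length ≡ p + r → G (f i) (f p) ≡ true → ClosedWalk G
  bypass i p r i<p ℓ≡p+r jump = closedWalk (suc (i + r)) g adjacent′ closed′
    where
    g : ℕ → Fin n
    g k with k ≤? i
    ... | yes _ = f k
    ... | no _ = f (p + (k ∸ suc i))
    g-before : ∀ k → k ≤ i → g k ≡ f k
    g-before k k≤i with k ≤? i
    ... | yes _ = refl
    ... | no k≰i = ⊥-elim (k≰i k≤i)
    g-after : ∀ t → g (suc (i + t)) ≡ f (p + t)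
    g-after t with suc (i + t) ≤? i
    ... | yes i<i = ⊥-elim (<⇒≱ (s≤s (m≤m+n i t)) i<i)
    ... | no _ = cong (λ z → f (p + z)) (m+n∸m≡n i t)
    g-jump : g (suc i) ≡ f p
    g-jump = trans (cong (g ∘ suc) (sym (+-identityʳ i))) (trans (g-after 0) (cong f (+-identityʳ p)))
    g-after-suc : ∀ t → g (suc (suc (i + t))) ≡ f (suc (p + t))
    g-after-suc t = trans (cong (g ∘ suc) (sym (+-suc i t))) (trans (g-after (suc t)) (cong f (+-suc p t)))
    p≤ℓ : p ≤ length
    p≤ℓ = subst (p ≤_) (sym ℓ≡p+r) (m≤m+n p r)
    adjacent′ : ∀ k → k < suc (i + r) → G (g k) (g (suc k)) ≡ true
    adjacent′ k k<ℓ′ with <-cmp k i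
    ... | tri< k<i _ _ = trans (cong₂ G (g-before k (<⇒≤ k<i)) (g-before (suc k) k<i))
                           (adjacent k (<-≤-trans k<i (≤-trans (<⇒≤ i<p) p≤ℓ)))
    ... | tri≈ _ refl _ = trans (cong₂ G (g-before k ≤-refl) g-jump) jump
    ... | tri> _ _ i<k with m≤n⇒∃[o]m+o≡n i<k
    ...   | t , refl = trans (cong₂ G (g-after t) (g-after-suc t))
                         (adjacent (p + t) (subst (p + t <_) (sym ℓ≡p+r)
                           (+-monoʳ-< p (+-cancelˡ-< (suc i) t r k<ℓ′))))
    closed′ : g (suc (i + r)) ≡ g 0
    closed′ = trans (g-after r) (trans (cong f (sym ℓ≡p+r)) (trans closed (sym (g-before 0 z≤n))))

isOdd-double : ∀ k → isOdd (2 * k) ≡ false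
isOdd-double k = begin
  isOdd (k + (k + 0))         ≡⟨ isOdd-+ k (k + 0) ⟩
  isOdd k xor isOdd (k + 0)   ≡⟨ cong (λ z → isOdd k xor isOdd z) (+-identityʳ k) ⟩
  isOdd k xor isOdd k         ≡⟨ xor-same (isOdd k) ⟩
  false                       ∎
  where open ≡-Reasoning

part-shorter : ∀ e {a b ℓ} → a + b ≡ 2 * e + ℓ → 2 * e < b → a < ℓ
part-shorter e {a} {b} {ℓ} sum 2e<b = +-cancelˡ-< (2 * e) a ℓ (begin-strict
  2 * e + a  ≡⟨ +-comm (2 * e) a ⟩
  a + 2 * e  <⟨ +-monoʳ-< a 2e<b ⟩
  a + b      ≡⟨ sum ⟩
  2 * e + ℓ  ∎)
  where open ≤-Reasoning

OddBelow : ℕ → ℕ → Set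
OddBelow ℓ a = isOdd a ≡ true × a < ℓ

-- a and b are the lengths of two closed walks into which a closed walk of length ℓ splits, sharing 2e edges.
odd-shorter-part : ∀ e {a b ℓ} → a + b ≡ 2 * e + ℓ → 2 * e < a → 2 * e < b → isOdd ℓ ≡ true →
  OddBelow ℓ a ⊎ OddBelow ℓ b
odd-shorter-part e {a} {b} {ℓ} sum 2e<a 2e<b odd with isOdd a in odd-a
... | true = inj₁ (refl , part-shorter e sum 2e<b)
... | false = inj₂ (odd-b , part-shorter e (trans (+-comm b a) sum) 2e<a)
  where
  open ≡-Reasoning
  odd-b : isOdd b ≡ true
  odd-b = begin
    isOdd b                   ≡⟨⟩
    false xor isOdd b         ≡⟨ cong (_xor isOdd b) odd-a ⟨
    isOdd a xor isOdd b       ≡⟨ isOdd-+ a b ⟨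
    isOdd (a + b)             ≡⟨ cong isOdd sum ⟩
    isOdd (2 * e + ℓ)         ≡⟨ isOdd-+ (2 * e) ℓ ⟩
    isOdd (2 * e) xor isOdd ℓ ≡⟨ cong₂ _xor_ (isOdd-double e) odd ⟩
    true                      ∎

repeat-lengths : ∀ d i r → suc d + suc (i + r) ≡ suc (suc (i + d)) + r
repeat-lengths = solve-∀

chord-lengths : ∀ d i o → suc (suc (suc d)) + suc (i + suc o) ≡ 2 * 1 + (suc (suc i + suc d) + o)
chord-lengths = solve-∀

bypass-long : ∀ i o j → ¬ (i ≡ 0 × suc j ≡ suc j + o) → 2 < suc (i + suc o)
bypass-long zero zero j not-closing = ⊥-elim (not-closing (refl , sym (+-identityʳ (suc j))))
bypass-long zero (suc o) j _ = s≤s (s≤s (s≤s z≤n))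
bypass-long (suc i) o j _ = s≤s (s≤s (≤-trans (s≤s z≤n) (m≤n+m (suc o) i)))

ShorterOddClosedWalk : ∀ {n} → Graph n → ℕ → Set
ShorterOddClosedWalk G ℓ = Σ (OddClosedWalk G) λ W → ClosedWalk.length (proj₁ W) < ℓ

module _ {n} {G : Graph n} where
  open ClosedWalk

  shorten-repeat : ((W , _) : OddClosedWalk G) → ∀ {i j} → i < j → j < length W → vertex W i ≡ vertex W j →
    ShorterOddClosedWalk G (length W)
  shorten-repeat (W@(closedWalk ℓ f adjacent _) , odd) {i} i<j j<ℓ fi≡fj
    with m≤n⇒∃[o]m+o≡n i<j | m≤n⇒∃[o]m+o≡n j<ℓ
  ... | d , refl | r , refl = choose (odd-shorter-part 0 (repeat-lengths d i r) (s≤s z≤n) (s≤s z≤n) odd)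
    where
    i+d<ℓ : i + d < ℓ
    i+d<ℓ = <-trans (n<1+n _) j<ℓ
    back : G (f (i + d)) (f i) ≡ true
    back = trans (cong (G (f (i + d))) fi≡fj) (adjacent (i + d) i+d<ℓ)
    jump : G (f i) (f (suc (suc i + d))) ≡ true
    jump = trans (cong (λ z → G z (f (suc (suc i + d)))) fi≡fj) (adjacent _ j<ℓ)
    choose : OddBelow ℓ (suc d) ⊎ OddBelow ℓ (suc (i + r)) → ShorterOddClosedWalk G ℓ
    choose (inj₁ (odd′ , shorter)) = (Shortcuts.loop W i d i+d<ℓ back , odd′) , shorter
    choose (inj₂ (odd′ , shorter)) =
      (Shortcuts.bypass W i _ r (<-trans i<j (n<1+n _)) refl jump , odd′) , shorter

  shorten-chord : Symmetric G → ((W , _) : OddClosedWalk G) → ∀ {i j} → i < j → j < length W →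
    G (vertex W i) (vertex W j) ≡ true → j ≢ suc i → ¬ (i ≡ 0 × suc j ≡ length W) →
    ShorterOddClosedWalk G (length W)
  shorten-chord symmetric (W@(closedWalk ℓ f _ _) , odd) {i} i<j j<ℓ chord j≢1+i not-closing
    with m≤n⇒∃[o]m+o≡n i<j | m≤n⇒∃[o]m+o≡n j<ℓ
  ... | zero , refl | _ = ⊥-elim (j≢1+i (cong suc (+-identityʳ i)))
  ... | suc d , refl | o , refl =
    choose (odd-shorter-part 1 (chord-lengths d i o) (s≤s (s≤s (s≤s z≤n))) (bypass-long i o _ not-closing) odd)
    where
    i+2+d≡j : i + suc (suc d) ≡ suc i + suc d
    i+2+d≡j = +-suc i (suc d)
    back : G (f (i + suc (suc d))) (f i) ≡ true
    back = trans (cong (λ z → G (f z) (f i)) i+2+d≡j) (trans (symmetric _ _) chord)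
    choose : OddBelow ℓ (suc (suc (suc d))) ⊎ OddBelow ℓ (suc (i + suc o)) → ShorterOddClosedWalk G ℓ
    choose (inj₁ (odd′ , shorter)) =
      (Shortcuts.loop W i (suc (suc d)) (subst (_< ℓ) (sym i+2+d≡j) j<ℓ) back , odd′) , shorter
    choose (inj₂ (odd′ , shorter)) =
      (Shortcuts.bypass W i _ (suc o) i<j (sym (+-suc _ o)) chord , odd′) , shorter

  inducedOddCycle-within : Symmetric G → ∀ fuel ((W , odd) : OddClosedWalk G) → length W ≤ fuel →
    Σ (OddClosedWalk G) (IsInducedCycle ∘ proj₁)
  inducedOddCycle-within symmetric zero (closedWalk zero _ _ _ , ()) _
  inducedOddCycle-within symmetric (suc fuel) W@(closedWalk ℓ f _ _ , _) ℓ≤fuel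
    with anyUpTo? (λ i → anyUpTo? (λ j → (i <? j) ×-dec (f i F.≟ f j)) ℓ) ℓ
  ... | yes (i , _ , j , j<ℓ , i<j , fi≡fj) =
    let W′ , shorter = shorten-repeat W i<j j<ℓ fi≡fj
    in inducedOddCycle-within symmetric fuel W′ (≤-pred (≤-trans shorter ℓ≤fuel))
  ... | no no-repeat
    with anyUpTo? (λ i → anyUpTo? (λ j → (i <? j) ×-dec (G (f i) (f j) B.≟ true) ×-dec ¬? (j ≟ suc i)
                                           ×-dec ¬? ((i ≟ 0) ×-dec (suc j ≟ ℓ))) ℓ) ℓ
  ...   | yes (i , _ , j , j<ℓ , i<j , chord , j≢1+i , not-closing) =
    let W′ , shorter = shorten-chord symmetric W i<j j<ℓ chord j≢1+i not-closing
    in inducedOddCycle-within symmetric fuel W′ (≤-pred (≤-trans shorter ℓ≤fuel))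
  ...   | no no-chord = W , inducedCycle distinct chordless
    where
    distinct : ∀ i j → i < j → j < ℓ → f i ≢ f j
    distinct i j i<j j<ℓ fi≡fj = no-repeat (i , <-trans i<j j<ℓ , j , j<ℓ , i<j , fi≡fj)
    chordless : ∀ i j → i < j → j < ℓ → G (f i) (f j) ≡ true → j ≡ suc i ⊎ (i ≡ 0 × suc j ≡ ℓ)
    chordless i j i<j j<ℓ e with j ≟ suc i | (i ≟ 0) ×-dec (suc j ≟ ℓ)
    ... | yes j≡1+i | _ = inj₁ j≡1+i
    ... | no _ | yes closing = inj₂ closing
    ... | no j≢1+i | no not-closing =
      ⊥-elim (no-chord (i , <-trans i<j j<ℓ , j , j<ℓ , i<j , e , j≢1+i , not-closing))

Follows : ℕ → ℕ → ℕ → Set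
Follows L x y = suc x ≡ y ⊎ (suc x ≡ L × y ≡ 0)

module Cycle (L : ℕ) where

  suc-mod : ∀ x → x < suc L → (suc x < suc L × suc x % suc L ≡ suc x) ⊎ (suc x ≡ suc L × suc x % suc L ≡ 0)
  suc-mod x x<L with m≤n⇒m<n∨m≡n x<L
  ... | inj₁ 1+x<L = inj₁ (1+x<L , m<n⇒m%n≡m 1+x<L)
  ... | inj₂ 1+x≡L = inj₂ (1+x≡L , trans (cong (_% suc L) 1+x≡L) (n%n≡0 (suc L)))

  step⇒follows : ∀ x y → x < suc L → T ((suc x % suc L) ≡ᵇ y) → Follows (suc L) x y
  step⇒follows x y x<L e with suc-mod x x<L
  ... | inj₁ (_ , mod≡) = inj₁ (trans (sym mod≡) (≡ᵇ⇒≡ _ _ e))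
  ... | inj₂ (1+x≡L , mod≡) = inj₂ (1+x≡L , trans (sym (≡ᵇ⇒≡ _ _ e)) mod≡)

  follows⇒step : ∀ x y → y < suc L → Follows (suc L) x y → T ((suc x % suc L) ≡ᵇ y)
  follows⇒step x y y<L (inj₁ 1+x≡y) =
    ≡⇒≡ᵇ _ _ (trans (m<n⇒m%n≡m (subst (_< suc L) (sym 1+x≡y) y<L)) 1+x≡y)
  follows⇒step x y _ (inj₂ (1+x≡L , y≡0)) =
    ≡⇒≡ᵇ _ _ (trans (cong (_% suc L) 1+x≡L) (trans (n%n≡0 (suc L)) (sym y≡0)))

  Adjacent : Fin (suc L) → Fin (suc L) → Set
  Adjacent a b = Follows (suc L) (toℕ a) (toℕ b) ⊎ Follows (suc L) (toℕ b) (toℕ a)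

  edge⇒adjacent : ∀ a b → cycleG (suc L) a b ≡ true → Adjacent a b
  edge⇒adjacent a b e with ∨-elim _ _ (Equivalence.from T-≡ e)
  ... | inj₁ ab = inj₁ (step⇒follows _ _ (FP.toℕ<n a) ab)
  ... | inj₂ ba = inj₂ (step⇒follows _ _ (FP.toℕ<n b) ba)

  adjacent⇒edge : ∀ a b → Adjacent a b → cycleG (suc L) a b ≡ true
  adjacent⇒edge a b (inj₁ ab) = Equivalence.to T-≡ (∨-introˡ _ _ (follows⇒step _ _ (FP.toℕ<n b) ab))
  adjacent⇒edge a b (inj₂ ba) =
    Equivalence.to T-≡ (∨-introʳ ((suc (toℕ a) % suc L) ≡ᵇ toℕ b) _ (follows⇒step _ _ (FP.toℕ<n a) ba))

  loopless : 1 ≤ L → Loopless (cycleG (suc L))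
  loopless 1≤L a = ¬-not λ e → [ no-self-follow , no-self-follow ]′ (edge⇒adjacent a a e)
    where
    no-self-follow : ¬ Follows (suc L) (toℕ a) (toℕ a)
    no-self-follow (inj₁ 1+a≡a) = 1+n≢n 1+a≡a
    no-self-follow (inj₂ (1+a≡L , a≡0)) = <⇒≢ (s≤s 1≤L) (trans (cong suc (sym a≡0)) 1+a≡L)

  around : ClosedWalk (cycleG (suc L))
  around = closedWalk (suc L) f adjacent closed
    where
    f : ℕ → Fin (suc L)
    f i = F.fromℕ< (m%n<n i (suc L))
    toℕ-f : ∀ i → toℕ (f i) ≡ i % suc L
    toℕ-f i = FP.toℕ-fromℕ< (m%n<n i (suc L))
    adjacent : ∀ i → i < suc L → cycleG (suc L) (f i) (f (suc i)) ≡ true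
    adjacent i i<L = adjacent⇒edge (f i) (f (suc i)) (inj₁ follows)
      where
      toℕ-fi : toℕ (f i) ≡ i
      toℕ-fi = trans (toℕ-f i) (m<n⇒m%n≡m i<L)
      follows : Follows (suc L) (toℕ (f i)) (toℕ (f (suc i)))
      follows with suc-mod i i<L
      ... | inj₁ (_ , mod≡) = inj₁ (trans (cong suc toℕ-fi) (sym (trans (toℕ-f (suc i)) mod≡)))
      ... | inj₂ (1+i≡L , mod≡) = inj₂ (trans (cong suc toℕ-fi) 1+i≡L , trans (toℕ-f (suc i)) mod≡)
    closed : f (suc L) ≡ f 0
    closed = FP.toℕ-injective (trans (toℕ-f (suc L)) (trans (n%n≡0 (suc L)) (sym (toℕ-f 0))))

  oddCycle-¬2-colorable : ∀ {S} → IsPackingSeq S → 1 ≤ L → isOdd (suc L) ≡ true →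
    ¬ HasPackingColoring S (cycleG (suc L)) 2
  oddCycle-¬2-colorable ps 1≤L odd = oddClosedWalk⇒¬2-colorable ps (loopless 1≤L) (around , odd)

-- Away from x, color by index parity, flipped below x: the flip separates the even ends 0 and L of the
-- cycle, and the parity break it creates sits at x, which has a color of its own.
module OddCycleColoring (L : ℕ) (odd : isOdd (suc L) ≡ true) (x : Fin (suc L)) where

  side : ℕ → Bool
  side y = isOdd y xor does (y <? toℕ x)

  below-step : ∀ {u} → u ≢ toℕ x → suc u ≢ toℕ x → does (u <? toℕ x) ≡ does (suc u <? toℕ x)
  below-step {u} u≢x 1+u≢x with u <? toℕ x
  ... | yes u<x = trans (dec-true (u <? toℕ x) u<x) (sym (dec-true (suc u <? toℕ x) (≤∧≢⇒< u<x 1+u≢x)))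
  ... | no u≮x = trans (dec-false (u <? toℕ x) u≮x)
                    (sym (dec-false (suc u <? toℕ x) (λ 1+u<x → u≮x (<-trans (n<1+n u) 1+u<x))))

  side-flips : ∀ {u v} → Follows (suc L) u v → u < suc L → u ≢ toℕ x → v ≢ toℕ x → side u ≢ side v
  side-flips {u} (inj₁ refl) _ u≢x 1+u≢x same = not-¬ refl (begin
    side u                                ≡⟨ same ⟩
    not (isOdd u) xor does (suc u <? toℕ x) ≡⟨ cong (not (isOdd u) xor_) (below-step u≢x 1+u≢x) ⟨
    not (isOdd u) xor does (u <? toℕ x)     ≡⟨ not-distribˡ-xor (isOdd u) _ ⟨
    not (side u)                          ∎)
    where open ≡-Reasoning
  side-flips {u} (inj₂ (1+u≡L , refl)) _ u≢x 0≢x same = false≢true (begin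
    false                          ≡⟨ cong₂ _xor_ even-u (dec-false (u <? toℕ x) x≤u) ⟨
    isOdd u xor does (u <? toℕ x)  ≡⟨ same ⟩
    does (0 <? toℕ x)              ≡⟨ dec-true (0 <? toℕ x) (n≢0⇒n>0 (λ x≡0 → 0≢x (sym x≡0))) ⟩
    true                           ∎)
    where
    open ≡-Reasoning
    even-u : isOdd u ≡ false
    even-u = trans (sym (not-involutive (isOdd u))) (cong not (trans (cong isOdd 1+u≡L) odd))
    x≤u : ¬ u < toℕ x
    x≤u u<x = u≢x (≤-antisym (<⇒≤ u<x)
                    (subst (toℕ x ≤_) (suc-injective (sym 1+u≡L)) (≤-pred (FP.toℕ<n x))))

  color : Fin (suc L) → Fin 3
  color v with v F.≟ x
  ... | yes _ = third
  ... | no _ = F.inject₁ (fromBool (side (toℕ v)))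

  color-x : color x ≡ third
  color-x with x F.≟ x
  ... | yes _ = refl
  ... | no x≢x = ⊥-elim (x≢x refl)

  color-other : ∀ {v} → v ≢ x → color v ≡ F.inject₁ (fromBool (side (toℕ v)))
  color-other {v} v≢x with v F.≟ x
  ... | yes v≡x = ⊥-elim (v≢x v≡x)
  ... | no _ = refl

  only-x : ∀ v → color v ≡ third → v ≡ x
  only-x v cv≡third with v F.≟ x
  ... | yes v≡x = v≡x
  ... | no _ = ⊥-elim (FP.fromℕ≢inject₁ (sym cv≡third))

  isolating : ∀ S → S 0 ≡ 1 → S 1 ≡ 1 → IsolatingColoring S (cycleG (suc L)) x
  isolating S S₀≡1 S₁≡1 = color , ok , color-x , only-x
    where
    S-side≡1 : ∀ b → S (toℕ (F.inject₁ (fromBool b))) ≡ 1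
    S-side≡1 false = S₀≡1
    S-side≡1 true = S₁≡1
    ok : IsPackingColoring S (cycleG (suc L)) color
    ok u v u≢v eq r = by-cases (u F.≟ x) (v F.≟ x)
      where
      by-cases : Dec (u ≡ x) → Dec (v ≡ x) → ⊥
      by-cases (yes u≡x) _ = u≢v (trans u≡x (sym (only-x v (trans (sym eq) (trans (cong color u≡x) color-x)))))
      by-cases (no u≢x) (yes v≡x) = u≢x (only-x u (trans eq (trans (cong color v≡x) color-x)))
      by-cases (no u≢x) (no v≢x) =
        [ u≢v , apart ]′ (reach-unit S (color-other u≢x) (S-side≡1 _) r)
        where
        toℕ-≢ : ∀ {a} → a ≢ x → toℕ a ≢ toℕ x
        toℕ-≢ a≢x e = a≢x (FP.toℕ-injective e)
        same-side : side (toℕ u) ≡ side (toℕ v)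
        same-side = fromBool-injective (FP.inject₁-injective
                      (trans (sym (color-other u≢x)) (trans eq (color-other v≢x))))
        apart : cycleG (suc L) u v ≡ true → ⊥
        apart uv with Cycle.edge⇒adjacent L u v uv
        ... | inj₁ u→v = side-flips u→v (FP.toℕ<n u) (toℕ-≢ u≢x) (toℕ-≢ v≢x) same-side
        ... | inj₂ v→u = side-flips v→u (FP.toℕ<n v) (toℕ-≢ v≢x) (toℕ-≢ u≢x) (sym same-side)

-- Vertex i of the cycle corresponds to the i-th vertex of the walk.
module SpanningInducedCycle {n} {G : Graph n} (symmetric : Symmetric G) (loopless : Loopless G)
  {L f adjacent closed} (induced : IsInducedCycle {G = G} (closedWalk (suc L) f adjacent closed))
  (visits : ∀ v → Σ ℕ λ i → i < suc L × f i ≡ v) where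
  open IsInducedCycle induced

  edge⇒adjacent : ∀ x y → x < suc L → y < suc L → G (f x) (f y) ≡ true →
    Follows (suc L) x y ⊎ Follows (suc L) y x
  edge⇒adjacent x y _ y<L e with <-cmp x y
  ... | tri≈ _ refl _ = ⊥-elim (edge⇒≢ {G = G} loopless e refl)
  ... | tri< x<y _ _ with chordless x y x<y y<L e
  ...   | inj₁ y≡1+x = inj₁ (inj₁ (sym y≡1+x))
  ...   | inj₂ (x≡0 , 1+y≡L) = inj₂ (inj₂ (1+y≡L , x≡0))
  edge⇒adjacent x y x<L _ e | tri> _ _ y<x with chordless y x y<x x<L (trans (symmetric (f y) (f x)) e)
  ...   | inj₁ x≡1+y = inj₂ (inj₁ (sym x≡1+y))
  ...   | inj₂ (y≡0 , 1+x≡L) = inj₁ (inj₂ (1+x≡L , y≡0))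

  follows⇒edge : ∀ x y → x < suc L → Follows (suc L) x y → G (f x) (f y) ≡ true
  follows⇒edge x y x<L (inj₁ 1+x≡y) = trans (cong (λ z → G (f x) (f z)) (sym 1+x≡y)) (adjacent x x<L)
  follows⇒edge x y x<L (inj₂ (1+x≡L , y≡0)) = begin
    G (f x) (f y)        ≡⟨ cong (λ z → G (f x) (f z)) y≡0 ⟩
    G (f x) (f 0)        ≡⟨ cong (G (f x)) closed ⟨
    G (f x) (f (suc L))  ≡⟨ cong (λ z → G (f x) (f z)) 1+x≡L ⟨
    G (f x) (f (suc x))  ≡⟨ adjacent x x<L ⟩
    true                 ∎
    where open ≡-Reasoning

  isomorphic : Isomorphic G (cycleG (suc L))
  isomorphic = isomorphic-from-enumeration G (cycleG (suc L)) (λ k → f (toℕ k)) injective onto edges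
    where
    injective : Injective _≡_ _≡_ (λ k → f (toℕ k))
    injective {a} {b} e with <-cmp (toℕ a) (toℕ b)
    ... | tri< a<b _ _ = ⊥-elim (distinct _ _ a<b (FP.toℕ<n b) e)
    ... | tri≈ _ a≡b _ = FP.toℕ-injective a≡b
    ... | tri> _ _ b<a = ⊥-elim (distinct _ _ b<a (FP.toℕ<n a) (sym e))
    onto : ∀ v → Σ (Fin (suc L)) λ k → f (toℕ k) ≡ v
    onto v with visits v
    ... | i , i<L , fi≡v = F.fromℕ< i<L , trans (cong f (FP.toℕ-fromℕ< i<L)) fi≡v
    edges : ∀ a b → G (f (toℕ a)) (f (toℕ b)) ≡ cycleG (suc L) a b
    edges a b = ⇔→≡ (mk⇔ (λ e → Cycle.adjacent⇒edge L a b (edge⇒adjacent _ _ (FP.toℕ<n a) (FP.toℕ<n b) e))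
                         λ e → [ follows⇒edge _ _ (FP.toℕ<n a)
                               , (λ b→a → trans (symmetric _ _) (follows⇒edge _ _ (FP.toℕ<n b) b→a)) ]′
                               (Cycle.edge⇒adjacent L a b e))

odd⇒2k+1 : ∀ ℓ → isOdd ℓ ≡ true → Σ ℕ λ k → ℓ ≡ 2 * k + 1
odd⇒2k+1 (suc zero) _ = 0 , refl
odd⇒2k+1 (suc (suc ℓ)) odd with odd⇒2k+1 ℓ (trans (sym (not-involutive (isOdd ℓ))) odd)
... | k , refl = suc k , two-more k
  where
  two-more : ∀ k → suc (suc (2 * k + 1)) ≡ 2 * suc k + 1
  two-more = solve-∀

oddCycle-if-critical : ∀ S → IsPackingSeq S → S 0 ≡ 1 → S 1 ≡ 1 → ∀ {n} (G : Graph n) → IsSimple G →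
  Is3ChiSCritical S G → Σ ℕ (λ k → 1 ≤ k × Isomorphic G (cycleG (2 * k + 1)))
oddCycle-if-critical S ps S₀≡1 S₁≡1 G simple critical
  with 2-colorable-or-oddClosedWalk S S₀≡1 S₁≡1 G simple
... | inj₁ col = ⊥-elim (chiS≡3⇒¬2-colorable {S} (proj₁ critical) col)
... | inj₂ W with inducedOddCycle-within (proj₁ simple) _ W ≤-refl
...   | C@(closedWalk (suc L) f adjacent closed , odd) , induced with odd⇒2k+1 (suc L) odd
...     | zero , refl = ⊥-elim (edge⇒≢ {G = G} (proj₂ simple) (adjacent 0 (s≤s z≤n)) (sym closed))
...     | suc k , 1+L≡ = suc k , s≤s z≤n , subst (λ m → Isomorphic G (cycleG m)) 1+L≡
          (SpanningInducedCycle.isomorphic (proj₁ simple) (proj₂ simple) {L} {f} {adjacent} {closed} induced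
             (critical⇒oddClosedWalk-visits-all S ps G simple critical C))

critical-if-oddCycle : ∀ S → IsPackingSeq S → S 0 ≡ 1 → S 1 ≡ 1 → ∀ {n} (G : Graph n) → Loopless G →
  Σ ℕ (λ k → 1 ≤ k × Isomorphic G (cycleG (2 * k + 1))) → Is3ChiSCritical S G
critical-if-oddCycle S ps S₀≡1 S₁≡1 G loopless (suc k , _ , iso) =
  critical-if-isomorphic S ps G (cycleG (suc L)) loopless
    (subst (λ m → Isomorphic G (cycleG m)) (+-comm L 1) iso)
    (λ x → OddCycleColoring.isolating L odd x S S₀≡1 S₁≡1) F.zero
    (Cycle.oddCycle-¬2-colorable L ps (s≤s z≤n) odd)
  where
  L : ℕ
  L = 2 * suc k
  odd : isOdd (suc L) ≡ true
  odd = cong not (isOdd-double (suc k))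

mainTheorem5 : (S : ℕ → ℕ) → IsPackingSeq S → (n : ℕ) → (G : Graph n) → IsSimple G →
    (S 0 ≡ 1 → S 1 ≡ 1 →
      (Is3ChiSCritical S G ⇔ Σ ℕ (λ k → 1 ≤ k × Isomorphic G (cycleG (2 * k + 1)))))
  × (S 0 ≡ 1 → 2 ≤ S 1 →
      (Is3ChiSCritical S G ⇔ (Isomorphic G (cycleG 3) ⊎ Isomorphic G (cycleG 4) ⊎ Isomorphic G (pathG 4))))
  × (2 ≤ S 0 →
      (Is3ChiSCritical S G ⇔ (Isomorphic G (cycleG 3) ⊎ Isomorphic G (pathG 3))))
mainTheorem5 S ps n G simple =
    (λ S₀≡1 S₁≡1 → mk⇔ (oddCycle-if-critical S ps S₀≡1 S₁≡1 G simple)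
                        (critical-if-oddCycle S ps S₀≡1 S₁≡1 G (proj₂ simple)))
  , (λ S₀≡1 2≤S₁ → mk⇔ (C₃-C₄-or-P₄-if-critical S ps S₀≡1 2≤S₁ G simple)
                        (critical-if-C₃-C₄-or-P₄ S ps S₀≡1 2≤S₁ G (proj₂ simple)))
  , (λ 2≤S₀ → mk⇔ (C₃-or-P₃-if-critical S ps 2≤S₀ G simple)
                   (critical-if-C₃-or-P₃ S ps 2≤S₀ G (proj₂ simple)))
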